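{- Let $S$ be a set with $n\ge 1$ elements. Define $\wp_n^{(1)}$ to be the set of all partitions of $S$, and for $m>1$ define $\wp_n^{(m)}$ to be the union, over all $p\in\wp_n^{(m-1)}$, of the set of all partitions of the set $p$ (regarding $p$ as the set of its blocks). For $m\ge 1$ and $k\ge 1$, let $S^{(m)}(n,k)$ denote the number of elements of $\wp_n^{(m)}$ that have exactly $k$ elements. Let $E_0(t)=e^t$, and for $m\ge 0$ let $E_{m+1}(t)=\exp(E_m(t)-1)$ (as formal power series). Then for all $m\ge 1$ and $k\ge 1$, $$\sum_{n=1}^\infty S^{(m)}(n,k)\,\frac{t^n}{n!} = \frac{(E_{m-1}(t)-1)^k}{k!}.$$ Equivalently, $S^{(m)}(n,k)$ equals E. T. Bell's generalized Stirling number of the second kind $\zeta_n^{(k,m)}$, defined by $\frac{(E_{m-1}(t)-1)^k}{k!}=\sum_n \zeta_n^{(k,m)} \frac{t^n}{n!}$.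
   Context: $S^{(m)}(n,k)$ is called the $m$-th order Stirling number of the second kind; for $m=1$ it is the ordinary Stirling number of the second kind $S(n,k)$. Its value does not depend on the choice of the $n$-element set $S$. -}

module Defs where

open import Data.Bool using (Bool; true; false; _∧_; _∨_; not; if_then_else_)
open import Data.Nat using (ℕ; zero; suc; _+_; _*_; _∸_; _^_; _/_; _%_; _≡ᵇ_; _!)
open import Data.Nat.Properties using (_!≢0)
open import Data.List using (List; []; _∷_; length; filter; upTo)
open import Data.Integer using (+_)
import Data.Rational as ℚ
open ℚ using (ℚ; 0ℚ; 1ℚ)
open import Relation.Binary.PropositionalEquality using (_≡_)
open import Relation.Nullary.Decidable using (Dec)
open import Data.Bool.Properties using (T?)

-- Finite sets coded as natural numbers (binary characteristic vectors).
-- A natural number A codes the finite set { x ∈ ℕ | bit x of A is 1 }.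
-- A subset of Fin s is coded by a number < 2 ^ s.

bit : ℕ → ℕ → Bool
bit A zero    = A % 2 ≡ᵇ 1
bit A (suc x) = bit (A / 2) x

_∈ₛ_ : ℕ → ℕ → Bool
x ∈ₛ A = bit A x

allBelow : ℕ → (ℕ → Bool) → Bool
allBelow zero    P = true
allBelow (suc s) P = allBelow s P ∧ P s

anyBelow : ℕ → (ℕ → Bool) → Bool
anyBelow zero    P = false
anyBelow (suc s) P = anyBelow s P ∨ P s

_⇒ᵇ_ : Bool → Bool → Bool
a ⇒ᵇ b = not a ∨ b

countBelow : ℕ → (ℕ → Bool) → ℕ
countBelow zero    P = 0
countBelow (suc s) P = countBelow s P + (if P s then 1 else 0)

size : ℕ → ℕ → ℕ
size s A = countBelow s (λ x → x ∈ₛ A)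

whole : ℕ → ℕ
whole s = 2 ^ s ∸ 1

-- q is a partition of p, where p ⊆ {0,…,s-1} and q is a set of subsets
-- of {0,…,s-1} (the blocks): every block is nonempty and contained in p,
-- distinct blocks are disjoint, and every element of p lies in a block.
isPartition : (s p q : ℕ) → Bool
isPartition s p q =
  allBelow (2 ^ s) (λ b → (b ∈ₛ q) ⇒ᵇ
      (anyBelow s (λ x → x ∈ₛ b) ∧ allBelow s (λ x → (x ∈ₛ b) ⇒ᵇ (x ∈ₛ p))))
  ∧ allBelow (2 ^ s) (λ b → allBelow (2 ^ s) (λ c →
      ((b ∈ₛ q) ∧ (c ∈ₛ q) ∧ not (b ≡ᵇ c)) ⇒ᵇ
        allBelow s (λ x → not ((x ∈ₛ b) ∧ (x ∈ₛ c)))))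
  ∧ allBelow s (λ x → (x ∈ₛ p) ⇒ᵇ anyBelow (2 ^ s) (λ b → (b ∈ₛ q) ∧ (x ∈ₛ b)))

-- Universe levels over S = {0,…,n-1}:
-- level 0 objects are codes < card n 0 = n (the elements of S);
-- level i+1 objects are sets of level-i objects, codes < card n (i+1) = 2 ^ card n i.
card : ℕ → ℕ → ℕ
card n zero    = n
card n (suc i) = 2 ^ card n i

-- ℘ n j q : q ∈ ℘_n^{(j+1)}.  Elements of ℘_n^{(j+1)} are level-(j+2) codes
-- (sets of level-(j+1) objects).
℘ : (n j : ℕ) → ℕ → Bool
℘ n zero    q = isPartition n (whole n) q
℘ n (suc j) q = anyBelow (card n (suc (suc j)))
                  (λ p → ℘ n j p ∧ isPartition (card n (suc j)) p q)

S⁽_⁾ : ℕ → ℕ → ℕ → ℕ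
S⁽ zero  ⁾ n k = 0     -- not used (m ≥ 1 in the paper)
S⁽ suc j ⁾ n k = countBelow (card n (suc (suc j)))
                   (λ q → ℘ n j q ∧ (size (card n (suc j)) q ≡ᵇ k))

-- Formal power series over ℚ, given by their (ordinary) coefficient sequence.

Series : Set
Series = ℕ → ℚ

sumTo : ℕ → (ℕ → ℚ) → ℚ
sumTo zero    f = f 0
sumTo (suc n) f = sumTo n f ℚ.+ f (suc n)

_·_ : Series → Series → Series
(f · g) n = sumTo n (λ i → f i ℚ.* g (n ∸ i))

oneS : Series
oneS zero    = 1ℚ
oneS (suc n) = 0ℚ

_^ₛ_ : Series → ℕ → Series
f ^ₛ zero  = oneS
f ^ₛ suc k = f · (f ^ₛ k)

minusOne : Series → Series
minusOne f zero    = f 0 ℚ.- 1ℚ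
minusOne f (suc n) = f (suc n)

inv! : ℕ → ℚ
inv! n = (+ 1 ℚ./ (n !)) {{n !≢0}}

_/!_ : ℚ → ℕ → ℚ
a /! n = a ℚ.* inv! n

-- exp ∘ g for a series g with g 0 = 0:  Σ_j g^j / j!  (the coefficient of t^n
-- only receives contributions from j ≤ n, since g^j has order ≥ j).
expS : Series → Series
expS g n = sumTo n (λ j → (g ^ₛ j) n /! j)

E : ℕ → Series
E zero    n = inv! n
E (suc m) = expS (minusOne (E m))

stirlingEGF : ℕ → ℕ → Series
stirlingEGF m k zero    = 0ℚ
stirlingEGF m k (suc n) = (+ (S⁽ m ⁾ (suc n) k) ℚ./ 1) /! suc n

-- Let S(r, k) count the partitions of an r-set into k blocks. Marking one block of a partition
-- with k + 1 blocks gives (k + 1) S(r, k + 1) = Σ_{i ≥ 1} C(r, i) S(r - i, k), which is also the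
-- recurrence of r! [t^r] (e^t - 1)^k / k!; so S(r, k) / r! is that coefficient.
-- Every element of ℘_n^{(m+1)} partitions exactly one p ∈ ℘_n^{(m)}, hence
-- S^{(m+1)}(n, k) = Σ_r S^{(m)}(n, r) S(r, k). Dividing by n! and using the induction hypothesis
-- S^{(m)}(n, r) / n! = [t^n] (E_{m-1}(t) - 1)^r / r!, the right side becomes the n-th coefficient of
-- (e^t - 1)^k / k! composed with E_{m-1}(t) - 1, which is (E_m(t) - 1)^k / k!.

module Submission where

open import Defs
open import Data.Nat using (ℕ; _≤_; _∸_; zero; suc)
open import Relation.Binary.PropositionalEquality using (_≡_)

module NatCast where

  open import Data.Nat as ℕ using (ℕ; zero; suc; _!)
  import Data.Nat.Properties as ℕP
  open ℕP using (_!≢0)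
  open import Data.Integer using (+_)
  open import Data.Rational as ℚ using (ℚ; 1ℚ; _+_; _*_; _/_)
  import Data.Rational.Properties as ℚP
  import Data.Rational.Unnormalised as ℚᵘ
  import Data.Rational.Unnormalised.Properties as ℚᵘP
  open import Relation.Binary.PropositionalEquality
  import Data.Integer.Solver
  module ℤ-Solver = Data.Integer.Solver.+-*-Solver

  ι : ℕ → ℚ
  ι n = + n / 1

  toℚᵘ-ι : ∀ n → ℚ.toℚᵘ (ι n) ℚᵘ.≃ ℚᵘ.mkℚᵘ (+ n) 0
  toℚᵘ-ι n = ℚP.toℚᵘ-fromℚᵘ (ℚᵘ.mkℚᵘ (+ n) 0)

  ι-suc : ∀ n → ι (suc n) ≡ 1ℚ + ι n
  ι-suc n = ℚP.toℚᵘ-injective (begin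
    ℚ.toℚᵘ (ι (suc n))                    ≈⟨ toℚᵘ-ι (suc n) ⟩
    ℚᵘ.mkℚᵘ (+ suc n) 0                   ≈⟨ ℚᵘ.*≡* (ℤ-solve 1 (λ x → (con (+ 1) :+ x) :* con (+ 1)
                                                              := (con (+ 1) :* con (+ 1) :+ x :* con (+ 1)) :* con (+ 1)) refl (+ n)) ⟩
    ℚᵘ.1ℚᵘ ℚᵘ.+ ℚᵘ.mkℚᵘ (+ n) 0           ≈⟨ ℚᵘP.+-congʳ ℚᵘ.1ℚᵘ (toℚᵘ-ι n) ⟨
    ℚᵘ.1ℚᵘ ℚᵘ.+ ℚ.toℚᵘ (ι n)              ≈⟨ ℚP.toℚᵘ-homo-+ 1ℚ (ι n) ⟨
    ℚ.toℚᵘ (1ℚ + ι n)                     ∎)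
    where
    open ℚᵘP.≃-Reasoning
    open ℤ-Solver using (con; _:+_; _:*_; _:=_) renaming (solve to ℤ-solve)

  ι-+ : ∀ a b → ι (a ℕ.+ b) ≡ ι a + ι b
  ι-+ zero    b = sym (ℚP.+-identityˡ (ι b))
  ι-+ (suc a) b = begin
    ι (suc (a ℕ.+ b))  ≡⟨ ι-suc (a ℕ.+ b) ⟩
    1ℚ + ι (a ℕ.+ b)   ≡⟨ cong (λ x → 1ℚ + x) (ι-+ a b) ⟩
    1ℚ + (ι a + ι b)   ≡⟨ ℚP.+-assoc 1ℚ (ι a) (ι b) ⟨
    (1ℚ + ι a) + ι b   ≡⟨ cong (_+ ι b) (ι-suc a) ⟨
    ι (suc a) + ι b    ∎
    where open ≡-Reasoning

  ι-* : ∀ a b → ι (a ℕ.* b) ≡ ι a * ι b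
  ι-* zero    b = sym (ℚP.*-zeroˡ (ι b))
  ι-* (suc a) b = begin
    ι (b ℕ.+ a ℕ.* b)       ≡⟨ ι-+ b (a ℕ.* b) ⟩
    ι b + ι (a ℕ.* b)       ≡⟨ cong (λ x → ι b + x) (ι-* a b) ⟩
    ι b + ι a * ι b         ≡⟨ cong (_+ ι a * ι b) (ℚP.*-identityˡ (ι b)) ⟨
    1ℚ * ι b + ι a * ι b    ≡⟨ ℚP.*-distribʳ-+ (ι b) 1ℚ (ι a) ⟨
    (1ℚ + ι a) * ι b        ≡⟨ cong (_* ι b) (ι-suc a) ⟨
    ι (suc a) * ι b         ∎
    where open ≡-Reasoning

  1/n*n≡1 : ∀ n .{{_ : ℕ.NonZero n}} → (+ 1 / n) * ι n ≡ 1ℚ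
  1/n*n≡1 n@(suc d) = ℚP.toℚᵘ-injective (begin
    ℚ.toℚᵘ ((+ 1 / n) * ι n)                          ≈⟨ ℚP.toℚᵘ-homo-* (+ 1 / n) (ι n) ⟩
    ℚ.toℚᵘ (+ 1 / n) ℚᵘ.* ℚ.toℚᵘ (ι n)                ≈⟨ ℚᵘP.*-cong (ℚP.toℚᵘ-fromℚᵘ (ℚᵘ.mkℚᵘ (+ 1) d)) (toℚᵘ-ι n) ⟩
    ℚᵘ.mkℚᵘ (+ 1) d ℚᵘ.* ℚᵘ.mkℚᵘ (+ n) 0              ≈⟨ ℚᵘ.*≡* (cong (λ m → + suc m) (ℕP.*-distribʳ-+ 1 d 0)) ⟩
    ℚᵘ.1ℚᵘ                                            ∎)
    where open ℚᵘP.≃-Reasoning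

  inv!*n!≡1 : ∀ n → inv! n * ι (n !) ≡ 1ℚ
  inv!*n!≡1 n = 1/n*n≡1 (n !) {{n !≢0}}

  *-cancelˡ-ι : ∀ n .{{_ : ℕ.NonZero n}} {x y} → ι n * x ≡ ι n * y → x ≡ y
  *-cancelˡ-ι n {x} {y} nx≡ny = begin
    x                          ≡⟨ ℚP.*-identityˡ x ⟨
    1ℚ * x                     ≡⟨ cong (_* x) (1/n*n≡1 n) ⟨
    ((+ 1 / n) * ι n) * x      ≡⟨ ℚP.*-assoc (+ 1 / n) (ι n) x ⟩
    (+ 1 / n) * (ι n * x)      ≡⟨ cong ((+ 1 / n) *_) nx≡ny ⟩
    (+ 1 / n) * (ι n * y)      ≡⟨ ℚP.*-assoc (+ 1 / n) (ι n) y ⟨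
    ((+ 1 / n) * ι n) * y      ≡⟨ cong (_* y) (1/n*n≡1 n) ⟩
    1ℚ * y                     ≡⟨ ℚP.*-identityˡ y ⟩
    y                          ∎
    where open ≡-Reasoning

module FiniteSums where

  open import Data.Bool using (true; false; if_then_else_)
  open import Data.Nat as ℕ using (ℕ; zero; suc; _≤_; _<_; _≤ᵇ_; _∸_)
  import Data.Nat.Properties as ℕP
  open import Data.Rational using (ℚ; 0ℚ; _+_; _*_)
  import Data.Rational.Properties as ℚP
  open import Data.Unit using (tt)
  open import Relation.Binary.PropositionalEquality
  open import Relation.Nullary using (contradiction)
  open import Data.Rational.Solver
  open +-*-Solver
  open ≡-Reasoning

  Σ : ℕ → (ℕ → ℚ) → ℚ
  Σ zero    f = 0ℚ
  Σ (suc n) f = Σ n f + f n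

  sumTo≡Σ : ∀ n f → sumTo n f ≡ Σ (suc n) f
  sumTo≡Σ zero    f = sym (ℚP.+-identityˡ (f 0))
  sumTo≡Σ (suc n) f = cong (_+ f (suc n)) (sumTo≡Σ n f)

  Σ-cong : ∀ n {f g : ℕ → ℚ} → (∀ i → i < n → f i ≡ g i) → Σ n f ≡ Σ n g
  Σ-cong zero    f≡g = refl
  Σ-cong (suc n) f≡g = cong₂ _+_ (Σ-cong n (λ i i<n → f≡g i (ℕP.m<n⇒m<1+n i<n))) (f≡g n (ℕP.n<1+n n))

  Σ-zero : ∀ n {f : ℕ → ℚ} → (∀ i → i < n → f i ≡ 0ℚ) → Σ n f ≡ 0ℚ
  Σ-zero n {f} f≡0 = trans (Σ-cong n f≡0) (Σ-0 n)
    where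
    Σ-0 : ∀ n → Σ n (λ _ → 0ℚ) ≡ 0ℚ
    Σ-0 zero    = refl
    Σ-0 (suc n) = cong (_+ 0ℚ) (Σ-0 n)

  Σ-+ : ∀ n (f g : ℕ → ℚ) → Σ n (λ i → f i + g i) ≡ Σ n f + Σ n g
  Σ-+ zero    f g = refl
  Σ-+ (suc n) f g = trans (cong (_+ (f n + g n)) (Σ-+ n f g))
    (solve 4 (λ a b c d → (a :+ b) :+ (c :+ d) := (a :+ c) :+ (b :+ d)) refl (Σ n f) (Σ n g) (f n) (g n))

  Σ-*ˡ : ∀ n a (f : ℕ → ℚ) → a * Σ n f ≡ Σ n (λ i → a * f i)
  Σ-*ˡ zero    a f = ℚP.*-zeroʳ a
  Σ-*ˡ (suc n) a f = trans (ℚP.*-distribˡ-+ a (Σ n f) (f n)) (cong (_+ (a * f n)) (Σ-*ˡ n a f))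

  Σ-*ʳ : ∀ n a (f : ℕ → ℚ) → Σ n f * a ≡ Σ n (λ i → f i * a)
  Σ-*ʳ n a f = trans (ℚP.*-comm (Σ n f) a) (trans (Σ-*ˡ n a f) (Σ-cong n (λ i _ → ℚP.*-comm a (f i))))

  Σ-swap : ∀ n m (F : ℕ → ℕ → ℚ) → Σ n (λ i → Σ m (F i)) ≡ Σ m (λ j → Σ n (λ i → F i j))
  Σ-swap zero    m F = sym (Σ-zero m (λ _ _ → refl))
  Σ-swap (suc n) m F = begin
    Σ n (λ i → Σ m (F i)) + Σ m (F n)               ≡⟨ cong (_+ Σ m (F n)) (Σ-swap n m F) ⟩
    Σ m (λ j → Σ n (λ i → F i j)) + Σ m (F n)       ≡⟨ Σ-+ m _ _ ⟨
    Σ m (λ j → Σ n (λ i → F i j) + F n j)           ∎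

  Σ-split : ∀ a b (f : ℕ → ℚ) → Σ (a ℕ.+ b) f ≡ Σ a f + Σ b (λ l → f (a ℕ.+ l))
  Σ-split a zero    f = trans (cong (λ x → Σ x f) (ℕP.+-identityʳ a)) (sym (ℚP.+-identityʳ _))
  Σ-split a (suc b) f = begin
    Σ (a ℕ.+ suc b) f                                   ≡⟨ cong (λ x → Σ x f) (ℕP.+-suc a b) ⟩
    Σ (a ℕ.+ b) f + f (a ℕ.+ b)                         ≡⟨ cong (_+ f (a ℕ.+ b)) (Σ-split a b f) ⟩
    (Σ a f + Σ b (λ l → f (a ℕ.+ l))) + f (a ℕ.+ b)     ≡⟨ ℚP.+-assoc (Σ a f) _ (f (a ℕ.+ b)) ⟩
    Σ a f + Σ (suc b) (λ l → f (a ℕ.+ l))               ∎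

  Σ-shift : ∀ n (f : ℕ → ℚ) → Σ (suc n) f ≡ f 0 + Σ n (λ i → f (suc i))
  Σ-shift n f = trans (Σ-split 1 n f) (cong (_+ Σ n (λ i → f (suc i))) (ℚP.+-identityˡ (f 0)))

  Σ-pad : ∀ n m (f : ℕ → ℚ) → n ≤ m → (∀ i → n ≤ i → i < m → f i ≡ 0ℚ) → Σ n f ≡ Σ m f
  Σ-pad n m f n≤m f≡0 = begin
    Σ n f                                     ≡⟨ ℚP.+-identityʳ _ ⟨
    Σ n f + 0ℚ                                ≡⟨ cong (Σ n f +_) (Σ-zero (m ∸ n) tail≡0) ⟨
    Σ n f + Σ (m ∸ n) (λ l → f (n ℕ.+ l))     ≡⟨ Σ-split n (m ∸ n) f ⟨
    Σ (n ℕ.+ (m ∸ n)) f                       ≡⟨ cong (λ x → Σ x f) (ℕP.m+[n∸m]≡n n≤m) ⟩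
    Σ m f                                     ∎
    where
    tail≡0 : ∀ l → l < m ∸ n → f (n ℕ.+ l) ≡ 0ℚ
    tail≡0 l l< = f≡0 (n ℕ.+ l) (ℕP.m≤m+n n l) (subst (n ℕ.+ l <_) (ℕP.m+[n∸m]≡n n≤m) (ℕP.+-monoʳ-< n l<))

  Σ-triangle : ∀ N (F : ℕ → ℕ → ℚ) →
    Σ N (λ r → Σ (suc r) (λ i → F i r)) ≡ Σ N (λ i → Σ (N ∸ i) (λ l → F i (i ℕ.+ l)))
  Σ-triangle N F = begin
    Σ N (λ r → Σ (suc r) (λ i → F i r))         ≡⟨ Σ-cong N column ⟩
    Σ N (λ r → Σ N (λ i → keepIf≤ i r (F i r)))     ≡⟨ Σ-swap N N _ ⟩
    Σ N (λ i → Σ N (λ r → keepIf≤ i r (F i r)))     ≡⟨ Σ-cong N (λ i i<N → row i (ℕP.<⇒≤ i<N)) ⟩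
    Σ N (λ i → Σ (N ∸ i) (λ l → F i (i ℕ.+ l))) ∎
    where
    keepIf≤ : ℕ → ℕ → ℚ → ℚ
    keepIf≤ i r x = if i ≤ᵇ r then x else 0ℚ

    keepIf≤-true : ∀ {i r} x → i ≤ r → keepIf≤ i r x ≡ x
    keepIf≤-true {i} {r} x i≤r with i ≤ᵇ r | ℕP.≤⇒≤ᵇ i≤r
    ... | true | _ = refl

    keepIf≤-false : ∀ {i r} x → r < i → keepIf≤ i r x ≡ 0ℚ
    keepIf≤-false {i} {r} x r<i with i ≤ᵇ r | ℕP.≤ᵇ⇒≤ i r
    ... | true  | i≤r = contradiction (i≤r tt) (ℕP.<⇒≱ r<i)
    ... | false | _   = refl

    column : ∀ r → r < N → Σ (suc r) (λ i → F i r) ≡ Σ N (λ i → keepIf≤ i r (F i r))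
    column r r<N = trans (Σ-cong (suc r) (λ i i≤r → sym (keepIf≤-true (F i r) (ℕP.≤-pred i≤r))))
      (Σ-pad (suc r) N _ r<N (λ i r<i _ → keepIf≤-false (F i r) r<i))

    row : ∀ i → i ≤ N → Σ N (λ r → keepIf≤ i r (F i r)) ≡ Σ (N ∸ i) (λ l → F i (i ℕ.+ l))
    row i i≤N = begin
      Σ N (λ r → keepIf≤ i r (F i r))                       ≡⟨ cong (λ x → Σ x _) (ℕP.m+[n∸m]≡n i≤N) ⟨
      Σ (i ℕ.+ (N ∸ i)) (λ r → keepIf≤ i r (F i r))         ≡⟨ Σ-split i (N ∸ i) _ ⟩
      Σ i (λ r → keepIf≤ i r (F i r)) + Σ (N ∸ i) (λ l → keepIf≤ i (i ℕ.+ l) (F i (i ℕ.+ l)))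
        ≡⟨ cong₂ _+_ (Σ-zero i (λ r r<i → keepIf≤-false (F i r) r<i))
                     (Σ-cong (N ∸ i) (λ l _ → keepIf≤-true (F i (i ℕ.+ l)) (ℕP.m≤m+n i l))) ⟩
      0ℚ + Σ (N ∸ i) (λ l → F i (i ℕ.+ l))              ≡⟨ ℚP.+-identityˡ _ ⟩
      Σ (N ∸ i) (λ l → F i (i ℕ.+ l))                   ∎

module PowerSeries where

  open FiniteSums
  open import Data.Nat as ℕ using (ℕ; zero; suc; _≤_; _<_; _∸_; s≤s)
  import Data.Nat.Properties as ℕP
  open import Data.Rational using (0ℚ; 1ℚ; _+_; _*_)
  import Data.Rational.Properties as ℚP
  open import Relation.Binary.PropositionalEquality
  open import Data.Rational.Solver
  open +-*-Solver
  open ≡-Reasoning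

  ·-coeff : ∀ (a b : Series) n → (a · b) n ≡ Σ (suc n) (λ i → a i * b (n ∸ i))
  ·-coeff a b n = sumTo≡Σ n _

  ·-cong : ∀ {a a′ b b′ : Series} → (∀ m → a m ≡ a′ m) → (∀ m → b m ≡ b′ m) →
    ∀ n → (a · b) n ≡ (a′ · b′) n
  ·-cong {a} {a′} {b} {b′} a≡a′ b≡b′ n = begin
    (a · b) n                             ≡⟨ ·-coeff a b n ⟩
    Σ (suc n) (λ i → a i * b (n ∸ i))     ≡⟨ Σ-cong (suc n) (λ i _ → cong₂ _*_ (a≡a′ i) (b≡b′ (n ∸ i))) ⟩
    Σ (suc n) (λ i → a′ i * b′ (n ∸ i))   ≡⟨ ·-coeff a′ b′ n ⟨
    (a′ · b′) n                           ∎

  ·-assoc : ∀ (a b c : Series) n → ((a · b) · c) n ≡ (a · (b · c)) n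
  ·-assoc a b c n = begin
    ((a · b) · c) n
      ≡⟨ ·-coeff (a · b) c n ⟩
    Σ N (λ r → (a · b) r * c (n ∸ r))
      ≡⟨ Σ-cong N (λ r _ → trans (cong (_* c (n ∸ r)) (·-coeff a b r)) (Σ-*ʳ (suc r) (c (n ∸ r)) _)) ⟩
    Σ N (λ r → Σ (suc r) (λ i → (a i * b (r ∸ i)) * c (n ∸ r)))
      ≡⟨ Σ-triangle N (λ i r → (a i * b (r ∸ i)) * c (n ∸ r)) ⟩
    Σ N (λ i → Σ (N ∸ i) (λ l → (a i * b ((i ℕ.+ l) ∸ i)) * c (n ∸ (i ℕ.+ l))))
      ≡⟨ Σ-cong N (λ i i<N → inner i (ℕP.≤-pred i<N)) ⟩
    Σ N (λ i → a i * (b · c) (n ∸ i))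
      ≡⟨ ·-coeff a (b · c) n ⟨
    (a · (b · c)) n ∎
    where
    N = suc n
    inner : ∀ i → i ≤ n → Σ (N ∸ i) (λ l → (a i * b ((i ℕ.+ l) ∸ i)) * c (n ∸ (i ℕ.+ l))) ≡ a i * (b · c) (n ∸ i)
    inner i i≤n = begin
      Σ (N ∸ i) (λ l → (a i * b ((i ℕ.+ l) ∸ i)) * c (n ∸ (i ℕ.+ l)))
        ≡⟨ Σ-cong (N ∸ i) (λ l _ → trans (cong₂ (λ u v → (a i * b u) * c v) (ℕP.m+n∸m≡n i l) (sym (ℕP.∸-+-assoc n i l)))
                                           (ℚP.*-assoc (a i) (b l) (c (n ∸ i ∸ l)))) ⟩
      Σ (N ∸ i) (λ l → a i * (b l * c (n ∸ i ∸ l)))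
        ≡⟨ cong (λ x → Σ x (λ l → a i * (b l * c (n ∸ i ∸ l)))) (ℕP.+-∸-assoc 1 i≤n) ⟩
      Σ (suc (n ∸ i)) (λ l → a i * (b l * c (n ∸ i ∸ l)))
        ≡⟨ Σ-*ˡ (suc (n ∸ i)) (a i) _ ⟨
      a i * Σ (suc (n ∸ i)) (λ l → b l * c (n ∸ i ∸ l))
        ≡⟨ cong (a i *_) (·-coeff b c (n ∸ i)) ⟨
      a i * (b · c) (n ∸ i) ∎

  oneS-·ˡ : ∀ (h : Series) n → (oneS · h) n ≡ h n
  oneS-·ˡ h n = begin
    (oneS · h) n                                        ≡⟨ ·-coeff oneS h n ⟩
    Σ (suc n) (λ i → oneS i * h (n ∸ i))                ≡⟨ Σ-shift n _ ⟩
    1ℚ * h n + Σ n (λ i → 0ℚ * h (n ∸ suc i))           ≡⟨ cong₂ _+_ (ℚP.*-identityˡ (h n))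
                                                             (Σ-zero n (λ i _ → ℚP.*-zeroˡ (h (n ∸ suc i)))) ⟩
    h n + 0ℚ                                            ≡⟨ ℚP.+-identityʳ (h n) ⟩
    h n                                                 ∎

  ^ₛ-cong : ∀ {f f′ : Series} → (∀ m → f m ≡ f′ m) → ∀ k n → (f ^ₛ k) n ≡ (f′ ^ₛ k) n
  ^ₛ-cong f≡f′ zero    n = refl
  ^ₛ-cong f≡f′ (suc k) n = ·-cong f≡f′ (^ₛ-cong f≡f′ k) n

  ^ₛ-+ : ∀ (g : Series) i l n → (g ^ₛ (i ℕ.+ l)) n ≡ ((g ^ₛ i) · (g ^ₛ l)) n
  ^ₛ-+ g zero    l n = sym (oneS-·ˡ (g ^ₛ l) n)
  ^ₛ-+ g (suc i) l n = trans (·-cong {g} {g} (λ _ → refl) (^ₛ-+ g i l) n) (sym (·-assoc g (g ^ₛ i) (g ^ₛ l) n))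

  ^ₛ-vanishes-below : ∀ (g : Series) → g 0 ≡ 0ℚ → ∀ j n → n < j → (g ^ₛ j) n ≡ 0ℚ
  ^ₛ-vanishes-below g g0≡0 (suc j) n n<j = trans (·-coeff g (g ^ₛ j) n) (Σ-zero (suc n) term≡0)
    where
    term≡0 : ∀ i → i < suc n → g i * (g ^ₛ j) (n ∸ i) ≡ 0ℚ
    term≡0 zero    _   = trans (cong (_* (g ^ₛ j) n) g0≡0) (ℚP.*-zeroˡ ((g ^ₛ j) n))
    term≡0 (suc i) i<n = trans (cong (g (suc i) *_) (^ₛ-vanishes-below g g0≡0 j (n ∸ suc i) (n∸i<j n i<n n<j)))
                               (ℚP.*-zeroʳ (g (suc i)))
      where
      n∸i<j : ∀ n → suc i < suc n → n < suc j → n ∸ suc i < j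
      n∸i<j zero    (s≤s ()) _
      n∸i<j (suc n) _ (s≤s n<j) = ℕP.≤-<-trans (ℕP.m∸n≤m n i) n<j

  -- f(g(t)); only meaningful when g 0 ≡ 0, since then no power g ^ r with r > n reaches t ^ n.
  _∘ₛ_ : Series → Series → Series
  (f ∘ₛ g) n = Σ (suc n) (λ r → f r * (g ^ₛ r) n)

  ∘ₛ-pad : ∀ f (g : Series) → g 0 ≡ 0ℚ → ∀ n M → n < M → (f ∘ₛ g) n ≡ Σ M (λ r → f r * (g ^ₛ r) n)
  ∘ₛ-pad f g g0≡0 n M n<M = Σ-pad (suc n) M _ n<M
    (λ r n<r _ → trans (cong (f r *_) (^ₛ-vanishes-below g g0≡0 r n n<r)) (ℚP.*-zeroʳ (f r)))

  private
    interchange : ∀ a b c d → (a * b) * (c * d) ≡ (a * c) * (b * d)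
    interchange = solve 4 (λ a b c d → (a :* b) :* (c :* d) := (a :* c) :* (b :* d)) refl

  ·-∘ₛ-expand : ∀ f h (g : Series) → g 0 ≡ 0ℚ → ∀ n →
    ((f ∘ₛ g) · (h ∘ₛ g)) n ≡ Σ (suc n) (λ i → Σ (suc n) (λ l → (f i * h l) * (g ^ₛ (i ℕ.+ l)) n))
  ·-∘ₛ-expand f h g g0≡0 n = begin
    ((f ∘ₛ g) · (h ∘ₛ g)) n
      ≡⟨ ·-coeff (f ∘ₛ g) (h ∘ₛ g) n ⟩
    Σ N (λ a → (f ∘ₛ g) a * (h ∘ₛ g) (n ∸ a))
      ≡⟨ Σ-cong N (λ a a<N → product a a<N) ⟩
    Σ N (λ a → Σ N (λ i → Σ N (λ l → (f i * h l) * ((g ^ₛ i) a * (g ^ₛ l) (n ∸ a)))))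
      ≡⟨ Σ-swap N N _ ⟩
    Σ N (λ i → Σ N (λ a → Σ N (λ l → (f i * h l) * ((g ^ₛ i) a * (g ^ₛ l) (n ∸ a)))))
      ≡⟨ Σ-cong N (λ i _ → Σ-swap N N _) ⟩
    Σ N (λ i → Σ N (λ l → Σ N (λ a → (f i * h l) * ((g ^ₛ i) a * (g ^ₛ l) (n ∸ a)))))
      ≡⟨ Σ-cong N (λ i _ → Σ-cong N (λ l _ → power i l)) ⟩
    Σ N (λ i → Σ N (λ l → (f i * h l) * (g ^ₛ (i ℕ.+ l)) n)) ∎
    where
    N = suc n
    product : ∀ a → a < N → (f ∘ₛ g) a * (h ∘ₛ g) (n ∸ a)
                          ≡ Σ N (λ i → Σ N (λ l → (f i * h l) * ((g ^ₛ i) a * (g ^ₛ l) (n ∸ a))))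
    product a a<N = begin
      (f ∘ₛ g) a * (h ∘ₛ g) (n ∸ a)
        ≡⟨ cong₂ _*_ (∘ₛ-pad f g g0≡0 a N a<N) (∘ₛ-pad h g g0≡0 (n ∸ a) N (s≤s (ℕP.m∸n≤m n a))) ⟩
      Σ N (λ i → f i * (g ^ₛ i) a) * Σ N (λ l → h l * (g ^ₛ l) (n ∸ a))
        ≡⟨ Σ-*ʳ N _ _ ⟩
      Σ N (λ i → f i * (g ^ₛ i) a * Σ N (λ l → h l * (g ^ₛ l) (n ∸ a)))
        ≡⟨ Σ-cong N (λ i _ → trans (Σ-*ˡ N (f i * (g ^ₛ i) a) _)
                                (Σ-cong N (λ l _ → interchange (f i) ((g ^ₛ i) a) (h l) ((g ^ₛ l) (n ∸ a))))) ⟩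
      Σ N (λ i → Σ N (λ l → (f i * h l) * ((g ^ₛ i) a * (g ^ₛ l) (n ∸ a)))) ∎
    power : ∀ i l → Σ N (λ a → (f i * h l) * ((g ^ₛ i) a * (g ^ₛ l) (n ∸ a))) ≡ (f i * h l) * (g ^ₛ (i ℕ.+ l)) n
    power i l = begin
      Σ N (λ a → (f i * h l) * ((g ^ₛ i) a * (g ^ₛ l) (n ∸ a)))  ≡⟨ Σ-*ˡ N (f i * h l) _ ⟨
      (f i * h l) * Σ N (λ a → (g ^ₛ i) a * (g ^ₛ l) (n ∸ a))    ≡⟨ cong (f i * h l *_) (·-coeff (g ^ₛ i) (g ^ₛ l) n) ⟨
      (f i * h l) * ((g ^ₛ i) · (g ^ₛ l)) n                      ≡⟨ cong (f i * h l *_) (^ₛ-+ g i l n) ⟨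
      (f i * h l) * (g ^ₛ (i ℕ.+ l)) n                           ∎

  ∘ₛ-·-expand : ∀ f h (g : Series) → g 0 ≡ 0ℚ → ∀ n →
    ((f · h) ∘ₛ g) n ≡ Σ (suc n) (λ i → Σ (suc n) (λ l → (f i * h l) * (g ^ₛ (i ℕ.+ l)) n))
  ∘ₛ-·-expand f h g g0≡0 n = begin
    ((f · h) ∘ₛ g) n
      ≡⟨ Σ-cong N (λ r _ → trans (cong (_* (g ^ₛ r) n) (·-coeff f h r)) (Σ-*ʳ (suc r) _ _)) ⟩
    Σ N (λ r → Σ (suc r) (λ i → (f i * h (r ∸ i)) * (g ^ₛ r) n))
      ≡⟨ Σ-triangle N (λ i r → (f i * h (r ∸ i)) * (g ^ₛ r) n) ⟩
    Σ N (λ i → Σ (N ∸ i) (λ l → (f i * h ((i ℕ.+ l) ∸ i)) * (g ^ₛ (i ℕ.+ l)) n))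
      ≡⟨ Σ-cong N (λ i _ → Σ-cong (N ∸ i) (λ l _ → cong (λ u → (f i * h u) * (g ^ₛ (i ℕ.+ l)) n) (ℕP.m+n∸m≡n i l))) ⟩
    Σ N (λ i → Σ (N ∸ i) (λ l → (f i * h l) * (g ^ₛ (i ℕ.+ l)) n))
      ≡⟨ Σ-cong N (λ i i<N → Σ-pad (N ∸ i) N _ (ℕP.m∸n≤m N i) (λ l N∸i≤l _ → high-power≡0 i l (ℕP.<⇒≤ i<N) N∸i≤l)) ⟩
    Σ N (λ i → Σ N (λ l → (f i * h l) * (g ^ₛ (i ℕ.+ l)) n)) ∎
    where
    N = suc n
    high-power≡0 : ∀ i l → i ≤ N → N ∸ i ≤ l → (f i * h l) * (g ^ₛ (i ℕ.+ l)) n ≡ 0ℚ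
    high-power≡0 i l i≤N N∸i≤l = trans
      (cong (f i * h l *_) (^ₛ-vanishes-below g g0≡0 (i ℕ.+ l) n
        (subst (_≤ i ℕ.+ l) (ℕP.m+[n∸m]≡n i≤N) (ℕP.+-monoʳ-≤ i N∸i≤l))))
      (ℚP.*-zeroʳ (f i * h l))

  ∘ₛ-· : ∀ f h (g : Series) → g 0 ≡ 0ℚ → ∀ n → ((f ∘ₛ g) · (h ∘ₛ g)) n ≡ ((f · h) ∘ₛ g) n
  ∘ₛ-· f h g g0≡0 n = trans (·-∘ₛ-expand f h g g0≡0 n) (sym (∘ₛ-·-expand f h g g0≡0 n))

  oneS-∘ₛ : ∀ (g : Series) n → (oneS ∘ₛ g) n ≡ oneS n
  oneS-∘ₛ g n = begin
    (oneS ∘ₛ g) n                                   ≡⟨ Σ-shift n _ ⟩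
    1ℚ * oneS n + Σ n (λ r → 0ℚ * (g ^ₛ suc r) n)   ≡⟨ cong₂ _+_ (ℚP.*-identityˡ (oneS n))
                                                         (Σ-zero n (λ r _ → ℚP.*-zeroˡ ((g ^ₛ suc r) n))) ⟩
    oneS n + 0ℚ                                     ≡⟨ ℚP.+-identityʳ (oneS n) ⟩
    oneS n                                          ∎

  ^ₛ-∘ₛ : ∀ f (g : Series) → g 0 ≡ 0ℚ → ∀ k n → ((f ^ₛ k) ∘ₛ g) n ≡ ((f ∘ₛ g) ^ₛ k) n
  ^ₛ-∘ₛ f g g0≡0 zero    n = oneS-∘ₛ g n
  ^ₛ-∘ₛ f g g0≡0 (suc k) n = trans (sym (∘ₛ-· f (f ^ₛ k) g g0≡0 n))
                                    (·-cong {f ∘ₛ g} {f ∘ₛ g} (λ _ → refl) (^ₛ-∘ₛ f g g0≡0 k) n)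

  expm1 : Series
  expm1 = minusOne (E 0)

  expm1-∘ₛ : ∀ (g : Series) → g 0 ≡ 0ℚ → ∀ n → (expm1 ∘ₛ g) n ≡ minusOne (expS g) n
  expm1-∘ₛ g g0≡0 zero    = refl
  expm1-∘ₛ g g0≡0 (suc n) = begin
    (expm1 ∘ₛ g) (suc n)
      ≡⟨ Σ-shift (suc n) _ ⟩
    expm1 0 * (g ^ₛ 0) (suc n) + Σ (suc n) (λ r → inv! (suc r) * (g ^ₛ suc r) (suc n))
      ≡⟨ cong ((g ^ₛ 0) (suc n) /! 0 +_) (Σ-cong (suc n) (λ r _ → ℚP.*-comm (inv! (suc r)) _)) ⟩
    (g ^ₛ 0) (suc n) /! 0 + Σ (suc n) (λ r → (g ^ₛ suc r) (suc n) /! suc r)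
      ≡⟨ Σ-shift (suc n) _ ⟨
    Σ (suc (suc n)) (λ j → (g ^ₛ j) (suc n) /! j)
      ≡⟨ sumTo≡Σ (suc n) _ ⟨
    minusOne (expS g) (suc n) ∎

  -- The left side is the n-th coefficient of ((e^t - 1)^k / k!) ∘ₛ g, truncated at any R ≥ n.
  ∘ₛ-expm1^ : ∀ (g : Series) → g 0 ≡ 0ℚ → ∀ k n R → n ≤ R →
    Σ (suc R) (λ r → (g ^ₛ r) n * ((expm1 ^ₛ k) r /! k)) ≡ (minusOne (expS g) ^ₛ k) n /! k
  ∘ₛ-expm1^ g g0≡0 k n R n≤R = begin
    Σ (suc R) (λ r → (g ^ₛ r) n * ((expm1 ^ₛ k) r /! k))
      ≡⟨ Σ-cong (suc R) (λ r _ → solve 3 (λ A B C → A :* (B :* C) := (B :* A) :* C) refl ((g ^ₛ r) n) ((expm1 ^ₛ k) r) (inv! k)) ⟩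
    Σ (suc R) (λ r → ((expm1 ^ₛ k) r * (g ^ₛ r) n) * inv! k)
      ≡⟨ Σ-*ʳ (suc R) (inv! k) _ ⟨
    Σ (suc R) (λ r → (expm1 ^ₛ k) r * (g ^ₛ r) n) * inv! k
      ≡⟨ cong (_* inv! k) (∘ₛ-pad (expm1 ^ₛ k) g g0≡0 n (suc R) (s≤s n≤R)) ⟨
    ((expm1 ^ₛ k) ∘ₛ g) n * inv! k
      ≡⟨ cong (_* inv! k) (trans (^ₛ-∘ₛ expm1 g g0≡0 k n) (^ₛ-cong (expm1-∘ₛ g g0≡0) k n)) ⟩
    (minusOne (expS g) ^ₛ k) n /! k ∎

module BitSets where

  open import Data.Bool using (Bool; true; false; _∨_; if_then_else_)
  open import Data.Bool.Properties using (∨-identityʳ; ∨-zeroʳ)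
  open import Data.Nat using (ℕ; zero; suc; _+_; _*_; _≤_; _<_; z≤n; s≤s; _∸_; _^_; _/_; _%_; _≡ᵇ_)
  import Data.Nat.Properties as ℕP
  import Data.Nat.DivMod as DM
  open import Relation.Binary.PropositionalEquality
  open ≡-Reasoning

  fromBool : Bool → ℕ
  fromBool b = if b then 1 else 0

  consBit : Bool → ℕ → ℕ
  consBit b h = fromBool b + h * 2

  consBit-/2 : ∀ b h → consBit b h / 2 ≡ h
  consBit-/2 false h = DM.m*n/n≡m h 2
  consBit-/2 true  h = trans (DM.+-distrib-/ 1 (h * 2) (subst (λ x → 1 + x < 2) (sym (DM.m*n%n≡0 h 2)) (s≤s (s≤s z≤n))))
                             (DM.m*n/n≡m h 2)

  bit-consBit-zero : ∀ b h → bit (consBit b h) 0 ≡ b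
  bit-consBit-zero false h = cong (_≡ᵇ 1) (DM.m*n%n≡0 h 2)
  bit-consBit-zero true  h = cong (_≡ᵇ 1) (DM.[m+kn]%n≡m%n 1 h 2)

  bit-consBit-suc : ∀ b h x → bit (consBit b h) (suc x) ≡ bit h x
  bit-consBit-suc b h x = cong (λ y → bit y x) (consBit-/2 b h)

  consBit-view : ∀ A → A ≡ consBit (bit A 0) (A / 2)
  consBit-view A = trans (DM.m≡m%n+[m/n]*n A 2) (cong (_+ (A / 2) * 2) (digit (A % 2) (DM.m%n<n A 2)))
    where
    digit : ∀ r → r < 2 → r ≡ fromBool (r ≡ᵇ 1)
    digit zero          _ = refl
    digit (suc zero)    _ = refl
    digit (suc (suc r)) (s≤s (s≤s ()))

  /2-< : ∀ A s → A < 2 ^ suc s → A / 2 < 2 ^ s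
  /2-< A s A< = DM.m<n*o⇒m/o<n (subst (A <_) (ℕP.*-comm 2 (2 ^ s)) A<)

  bit-empty : ∀ x → bit 0 x ≡ false
  bit-empty zero    = refl
  bit-empty (suc x) = bit-empty x

  bit-beyond : ∀ M q → q < 2 ^ M → ∀ c → M ≤ c → bit q c ≡ false
  bit-beyond zero    q (s≤s z≤n) c       _         = bit-empty c
  bit-beyond (suc M) q q<        (suc c) (s≤s M≤c) = bit-beyond M (q / 2) (/2-< q M q<) c M≤c

  bit-extensional : ∀ s A B → A < 2 ^ s → B < 2 ^ s → (∀ x → x < s → bit A x ≡ bit B x) → A ≡ B
  bit-extensional zero    A B (s≤s z≤n) (s≤s z≤n) _ = refl
  bit-extensional (suc s) A B A< B< same = begin
    A                          ≡⟨ consBit-view A ⟩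
    consBit (bit A 0) (A / 2)  ≡⟨ cong₂ consBit (same 0 (s≤s z≤n))
                                    (bit-extensional s (A / 2) (B / 2) (/2-< A s A<) (/2-< B s B<) (λ x x<s → same (suc x) (s≤s x<s))) ⟩
    consBit (bit B 0) (B / 2)  ≡⟨ consBit-view B ⟨
    B                          ∎

  consBit-+2^suc : ∀ β h b → consBit β h + 2 ^ suc b ≡ consBit β (h + 2 ^ b)
  consBit-+2^suc β h b = begin
    fromBool β + h * 2 + 2 * 2 ^ b      ≡⟨ ℕP.+-assoc (fromBool β) (h * 2) (2 * 2 ^ b) ⟩
    fromBool β + (h * 2 + 2 * 2 ^ b)    ≡⟨ cong (λ x → fromBool β + (h * 2 + x)) (ℕP.*-comm 2 (2 ^ b)) ⟩
    fromBool β + (h * 2 + 2 ^ b * 2)    ≡⟨ cong (fromBool β +_) (ℕP.*-distribʳ-+ 2 h (2 ^ b)) ⟨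
    fromBool β + (h + 2 ^ b) * 2        ∎

  bit-+2^ : ∀ b q → bit q b ≡ false → ∀ c → bit (q + 2 ^ b) c ≡ (bit q c ∨ (c ≡ᵇ b))
  bit-+2^ zero q q∌b c = begin
    bit (q + 1) c                              ≡⟨ cong (λ y → bit (y + 1) c) (consBit-view q) ⟩
    bit (consBit (bit q 0) (q / 2) + 1) c      ≡⟨ cong (λ β → bit (consBit β (q / 2) + 1) c) q∌b ⟩
    bit (consBit false (q / 2) + 1) c          ≡⟨ cong (λ y → bit y c) (ℕP.+-comm (q / 2 * 2) 1) ⟩
    bit (consBit true (q / 2)) c               ≡⟨ low c ⟩
    (bit q c ∨ (c ≡ᵇ 0))                       ∎
    where
    low : ∀ c → bit (consBit true (q / 2)) c ≡ (bit q c ∨ (c ≡ᵇ 0))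
    low zero    = trans (bit-consBit-zero true (q / 2)) (sym (∨-zeroʳ (bit q 0)))
    low (suc c) = trans (bit-consBit-suc true (q / 2) c) (sym (∨-identityʳ (bit q (suc c))))
  bit-+2^ (suc b) q q∌b c = begin
    bit (q + 2 ^ suc b) c                              ≡⟨ cong (λ y → bit (y + 2 ^ suc b) c) (consBit-view q) ⟩
    bit (consBit (bit q 0) (q / 2) + 2 ^ suc b) c      ≡⟨ cong (λ y → bit y c) (consBit-+2^suc (bit q 0) (q / 2) b) ⟩
    bit (consBit (bit q 0) (q / 2 + 2 ^ b)) c          ≡⟨ high c ⟩
    (bit q c ∨ (c ≡ᵇ suc b))                           ∎
    where
    high : ∀ c → bit (consBit (bit q 0) (q / 2 + 2 ^ b)) c ≡ (bit q c ∨ (c ≡ᵇ suc b))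
    high zero    = trans (bit-consBit-zero (bit q 0) (q / 2 + 2 ^ b)) (sym (∨-identityʳ (bit q 0)))
    high (suc c) = trans (bit-consBit-suc (bit q 0) (q / 2 + 2 ^ b) c) (bit-+2^ b (q / 2) q∌b c)

  _⊆⟨_⟩_ : ℕ → ℕ → ℕ → Bool
  B ⊆⟨ s ⟩ p = allBelow s (λ x → bit B x ⇒ᵇ bit p x)

  fromBits : ℕ → (ℕ → Bool) → ℕ
  fromBits zero    f = 0
  fromBits (suc s) f = consBit (f 0) (fromBits s (λ x → f (suc x)))

  bit-fromBits : ∀ s f x → x < s → bit (fromBits s f) x ≡ f x
  bit-fromBits (suc s) f zero    _         = bit-consBit-zero (f 0) (fromBits s (λ x → f (suc x)))
  bit-fromBits (suc s) f (suc x) (s≤s x<s) = trans (bit-consBit-suc (f 0) (fromBits s (λ x → f (suc x))) x)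
                                                   (bit-fromBits s (λ x → f (suc x)) x x<s)

  bit-whole : ∀ n x → x < n → bit (whole n) x ≡ true
  bit-whole (suc n) x x<n = trans (cong (λ y → bit y x) whole-suc) (go x x<n)
    where
    whole-suc : whole (suc n) ≡ consBit true (whole n)
    whole-suc = begin
      2 * 2 ^ n ∸ 1                  ≡⟨ cong (λ y → 2 * y ∸ 1) (ℕP.suc-pred (2 ^ n) {{ℕP.m^n≢0 2 n}}) ⟨
      2 * suc (2 ^ n ∸ 1) ∸ 1        ≡⟨ cong (_∸ 1) (ℕP.*-comm 2 (suc (2 ^ n ∸ 1))) ⟩
      consBit true (whole n)         ∎
    go : ∀ x → x < suc n → bit (consBit true (whole n)) x ≡ true
    go zero    _         = bit-consBit-zero true (whole n)
    go (suc x) (s≤s x<n) = trans (bit-consBit-suc true (whole n) x) (bit-whole n x x<n)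

module BoundedBool where

  open BitSets using (fromBool)
  open import Data.Bool using (Bool; true; false; _∧_; _∨_; not)
  open import Data.Bool.Properties using (∨-identityʳ; ∨-zeroʳ; ¬-not)
  open import Data.Nat using (ℕ; zero; suc; _+_; _≤_; _<_; z≤n; s≤s; _≡ᵇ_)
  import Data.Nat.Properties as ℕP
  open import Data.Product using (∃-syntax; _,_; _×_; proj₁; proj₂)
  open import Data.Empty using (⊥)
  open import Relation.Nullary using (¬_; contradiction)
  open import Relation.Binary.PropositionalEquality
  open import Relation.Binary.Definitions using (tri<; tri≈; tri>)
  open ≡-Reasoning

  ∧-true⁻ : ∀ {a b} → (a ∧ b) ≡ true → a ≡ true × b ≡ true
  ∧-true⁻ {true} {true} _ = refl , refl

  ∧-true : ∀ {a b} → a ≡ true → b ≡ true → (a ∧ b) ≡ true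
  ∧-true refl refl = refl

  ⇒ᵇ-true⁻ : ∀ {a b} → (a ⇒ᵇ b) ≡ true → a ≡ true → b ≡ true
  ⇒ᵇ-true⁻ {true} {true} _ _ = refl

  ⇒ᵇ-true : ∀ {a b} → (a ≡ true → b ≡ true) → (a ⇒ᵇ b) ≡ true
  ⇒ᵇ-true {true}  a⇒b = a⇒b refl
  ⇒ᵇ-true {false} _   = refl

  not-true⁻ : ∀ {a} → not a ≡ true → a ≡ false
  not-true⁻ {false} _ = refl

  not-true : ∀ {a} → a ≡ false → not a ≡ true
  not-true refl = refl

  true≢false : ∀ {a} → a ≡ true → a ≡ false → ⊥
  true≢false refl ()

  ¬true⇒false : ∀ {a} → ¬ (a ≡ true) → a ≡ false
  ¬true⇒false = ¬-not

  Bool-ext : ∀ {a b} → (a ≡ true → b ≡ true) → (b ≡ true → a ≡ true) → a ≡ b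
  Bool-ext {true}  {true}  _   _   = refl
  Bool-ext {true}  {false} a⇒b _   = sym (a⇒b refl)
  Bool-ext {false} {true}  _   b⇒a = b⇒a refl
  Bool-ext {false} {false} _   _   = refl

  ≡ᵇ-refl : ∀ m → (m ≡ᵇ m) ≡ true
  ≡ᵇ-refl zero    = refl
  ≡ᵇ-refl (suc m) = ≡ᵇ-refl m

  ≡ᵇ-true⁻ : ∀ m n → (m ≡ᵇ n) ≡ true → m ≡ n
  ≡ᵇ-true⁻ zero    zero    _ = refl
  ≡ᵇ-true⁻ (suc m) (suc n) e = cong suc (≡ᵇ-true⁻ m n e)

  ≢⇒≡ᵇ-false : ∀ m n → m ≢ n → (m ≡ᵇ n) ≡ false
  ≢⇒≡ᵇ-false m n m≢n = ¬true⇒false (λ e → m≢n (≡ᵇ-true⁻ m n e))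

  ≡⇒≡ᵇ-true : ∀ m n → m ≡ n → (m ≡ᵇ n) ≡ true
  ≡⇒≡ᵇ-true m .m refl = ≡ᵇ-refl m

  allBelow⇒ : ∀ n {P} → allBelow n P ≡ true → ∀ x → x < n → P x ≡ true
  allBelow⇒ (suc n) all x x<1+n with ℕP.<-cmp x n
  ... | tri< x<n _ _ = allBelow⇒ n (proj₁ (∧-true⁻ all)) x x<n
  ... | tri≈ _ refl _ = proj₂ (∧-true⁻ all)
  ... | tri> _ _ n<x = contradiction (ℕP.≤-pred x<1+n) (ℕP.<⇒≱ n<x)

  ⇒allBelow : ∀ n {P} → (∀ x → x < n → P x ≡ true) → allBelow n P ≡ true
  ⇒allBelow zero    _   = refl
  ⇒allBelow (suc n) all = ∧-true (⇒allBelow n (λ x x<n → all x (ℕP.m<n⇒m<1+n x<n))) (all n (ℕP.n<1+n n))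

  allBelow-cong : ∀ n {P Q : ℕ → Bool} → (∀ x → x < n → P x ≡ Q x) → allBelow n P ≡ allBelow n Q
  allBelow-cong zero    _   = refl
  allBelow-cong (suc n) P≡Q = cong₂ _∧_ (allBelow-cong n (λ x x<n → P≡Q x (ℕP.m<n⇒m<1+n x<n))) (P≡Q n (ℕP.n<1+n n))

  anyBelow⇒ : ∀ n {P} → anyBelow n P ≡ true → ∃[ x ] (x < n × P x ≡ true)
  anyBelow⇒ (suc n) {P} any with anyBelow n P in e
  ... | true  = let (x , x<n , Px) = anyBelow⇒ n e in x , ℕP.m<n⇒m<1+n x<n , Px
  ... | false = n , ℕP.n<1+n n , any

  ⇒anyBelow : ∀ n {P} x → x < n → P x ≡ true → anyBelow n P ≡ true
  ⇒anyBelow (suc n) {P} x x<1+n Px with ℕP.<-cmp x n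
  ... | tri< x<n _ _  = cong (_∨ P n) (⇒anyBelow n x x<n Px)
  ... | tri≈ _ refl _ = trans (cong (anyBelow n P ∨_) Px) (∨-zeroʳ (anyBelow n P))
  ... | tri> _ _ n<x  = contradiction (ℕP.≤-pred x<1+n) (ℕP.<⇒≱ n<x)

  countBelow-cong : ∀ n {P Q : ℕ → Bool} → (∀ x → x < n → P x ≡ Q x) → countBelow n P ≡ countBelow n Q
  countBelow-cong zero    _   = refl
  countBelow-cong (suc n) P≡Q = cong₂ _+_ (countBelow-cong n (λ x x<n → P≡Q x (ℕP.m<n⇒m<1+n x<n)))
                                           (cong fromBool (P≡Q n (ℕP.n<1+n n)))

  countBelow≤ : ∀ n P → countBelow n P ≤ n
  countBelow≤ zero    P = z≤n
  countBelow≤ (suc n) P with P n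
  ... | true  = ℕP.≤-trans (ℕP.≤-reflexive (ℕP.+-comm (countBelow n P) 1)) (s≤s (countBelow≤ n P))
  ... | false = ℕP.≤-trans (ℕP.≤-reflexive (ℕP.+-identityʳ (countBelow n P))) (ℕP.m≤n⇒m≤1+n (countBelow≤ n P))

  countBelow-all : ∀ n (P : ℕ → Bool) → (∀ x → x < n → P x ≡ true) → countBelow n P ≡ n
  countBelow-all zero    P _   = refl
  countBelow-all (suc n) P all = trans (cong₂ _+_ (countBelow-all n P (λ x x< → all x (ℕP.m<n⇒m<1+n x<)))
                                                  (cong fromBool (all n (ℕP.n<1+n n))))
                                       (ℕP.+-comm n 1)

  countBelow-none : ∀ n P → (∀ x → x < n → P x ≡ false) → countBelow n P ≡ 0
  countBelow-none zero    P _    = refl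
  countBelow-none (suc n) P none = cong₂ _+_ (countBelow-none n P (λ x x<n → none x (ℕP.m<n⇒m<1+n x<n)))
                                             (cong fromBool (none n (ℕP.n<1+n n)))

  countBelow≡0⇒ : ∀ n P → countBelow n P ≡ 0 → ∀ x → x < n → P x ≡ false
  countBelow≡0⇒ n P #P≡0 x x<n = ¬true⇒false (λ Px → ℕP.<⇒≢ (countBelow-pos n x<n Px) (sym #P≡0))
    where
    countBelow-pos : ∀ n {x} → x < n → P x ≡ true → 0 < countBelow n P
    countBelow-pos (suc n) {x} x<1+n Px with ℕP.<-cmp x n
    ... | tri< x<n _ _  = ℕP.<-≤-trans (countBelow-pos n x<n Px) (ℕP.m≤m+n (countBelow n P) _)
    ... | tri≈ _ refl _ = subst (λ b → 0 < countBelow n P + fromBool b) (sym Px)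
                            (subst (0 <_) (ℕP.+-comm 1 (countBelow n P)) (s≤s z≤n))
    ... | tri> _ _ n<x  = contradiction (ℕP.≤-pred x<1+n) (ℕP.<⇒≱ n<x)

  anyBelow≡nonzero : ∀ n P → anyBelow n P ≡ not (countBelow n P ≡ᵇ 0)
  anyBelow≡nonzero zero    P = refl
  anyBelow≡nonzero (suc n) P with P n
  ... | true  = trans (∨-zeroʳ (anyBelow n P)) (cong (λ z → not (z ≡ᵇ 0)) (ℕP.+-comm 1 (countBelow n P)))
  ... | false = trans (∨-identityʳ (anyBelow n P))
                      (trans (anyBelow≡nonzero n P) (cong (λ z → not (z ≡ᵇ 0)) (sym (ℕP.+-identityʳ (countBelow n P)))))

  countBelow-insert : ∀ M (P : ℕ → Bool) B → B < M → P B ≡ false →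
    countBelow M (λ c → P c ∨ (c ≡ᵇ B)) ≡ suc (countBelow M P)
  countBelow-insert (suc M) P B B<1+M PB≡false with ℕP.<-cmp B M
  ... | tri< B<M _ _ = cong₂ _+_ (countBelow-insert M P B B<M PB≡false)
                          (cong fromBool (trans (cong (P M ∨_) (≢⇒≡ᵇ-false M B (λ e → ℕP.<-irrefl (sym e) B<M)))
                                                (∨-identityʳ (P M))))
  ... | tri≈ _ refl _ = begin
    countBelow M (λ c → P c ∨ (c ≡ᵇ M)) + fromBool (P M ∨ (M ≡ᵇ M))
      ≡⟨ cong₂ _+_ (countBelow-cong M (λ c c<M → trans (cong (P c ∨_) (≢⇒≡ᵇ-false c M (λ e → ℕP.<-irrefl e c<M))) (∨-identityʳ (P c))))
                   (cong fromBool (trans (cong (P M ∨_) (≡ᵇ-refl M)) (∨-zeroʳ (P M)))) ⟩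
    countBelow M P + 1
      ≡⟨ ℕP.+-comm _ 1 ⟩
    suc (countBelow M P)
      ≡⟨ cong suc (ℕP.+-identityʳ (countBelow M P)) ⟨
    suc (countBelow M P + 0)
      ≡⟨ cong (λ z → suc (countBelow M P + fromBool z)) PB≡false ⟨
    suc (countBelow M P + fromBool (P M)) ∎
  ... | tri> _ _ M<B = contradiction (ℕP.≤-pred B<1+M) (ℕP.<⇒≱ M<B)

  countBelow-difference : ∀ n (P Q : ℕ → Bool) → (∀ x → x < n → Q x ≡ true → P x ≡ true) →
    countBelow n (λ x → P x ∧ not (Q x)) + countBelow n Q ≡ countBelow n P
  countBelow-difference zero    P Q _   = refl
  countBelow-difference (suc n) P Q Q⊆P = begin
    (a + fromBool (P n ∧ not (Q n))) + (b + fromBool (Q n))      ≡⟨ ℕP.+-assoc a _ _ ⟩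
    a + (fromBool (P n ∧ not (Q n)) + (b + fromBool (Q n)))      ≡⟨ cong (a +_) (ℕP.+-comm _ (b + fromBool (Q n))) ⟩
    a + ((b + fromBool (Q n)) + fromBool (P n ∧ not (Q n)))      ≡⟨ cong (a +_) (ℕP.+-assoc b _ _) ⟩
    a + (b + (fromBool (Q n) + fromBool (P n ∧ not (Q n))))      ≡⟨ ℕP.+-assoc a b _ ⟨
    (a + b) + (fromBool (Q n) + fromBool (P n ∧ not (Q n)))      ≡⟨ cong₂ _+_ (countBelow-difference n P Q (λ x x<n → Q⊆P x (ℕP.m<n⇒m<1+n x<n)))
                                                                       (last (P n) (Q n) (Q⊆P n (ℕP.n<1+n n))) ⟩
    countBelow n P + fromBool (P n)                              ∎
    where
    a = countBelow n (λ x → P x ∧ not (Q x))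
    b = countBelow n Q
    last : ∀ p q → (q ≡ true → p ≡ true) → fromBool q + fromBool (p ∧ not q) ≡ fromBool p
    last true  true  _   = refl
    last true  false _   = refl
    last false true  q⇒p = contradiction (q⇒p refl) (λ ())
    last false false _   = refl

module IndicatorSums where

  open NatCast using (ι; ι-+)
  open FiniteSums
  open BitSets
  open BoundedBool
  open import Data.Bool using (Bool; true; false; _∧_; _∨_; not)
  open import Data.Bool.Properties using (∨-identityʳ; ∨-zeroʳ)
  open import Data.Nat using (ℕ; zero; suc; _+_; _≤_; _<_; s≤s; _^_; _≡ᵇ_)
  import Data.Nat.Properties as ℕP
  open import Data.Rational as ℚ using (ℚ; 0ℚ; 1ℚ)
  import Data.Rational.Properties as ℚP
  open import Relation.Nullary using (contradiction)
  open import Relation.Binary.PropositionalEquality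
  open import Relation.Binary.Definitions using (tri<; tri≈; tri>)
  open ≡-Reasoning

  χ : Bool → ℚ
  χ true  = 1ℚ
  χ false = 0ℚ

  ι-countBelow : ∀ n P → ι (countBelow n P) ≡ Σ n (λ x → χ (P x))
  ι-countBelow zero    P = refl
  ι-countBelow (suc n) P = trans (ι-+ (countBelow n P) _) (cong₂ ℚ._+_ (ι-countBelow n P) (ι-fromBool (P n)))
    where
    ι-fromBool : ∀ b → ι (fromBool b) ≡ χ b
    ι-fromBool true  = refl
    ι-fromBool false = refl

  χ-∧ : ∀ a b → χ (a ∧ b) ≡ χ a ℚ.* χ b
  χ-∧ true  b = sym (ℚP.*-identityˡ (χ b))
  χ-∧ false b = sym (ℚP.*-zeroˡ (χ b))

  χ-anyBelow : ∀ M (X : ℕ → Bool) → (∀ a b → a < M → b < M → X a ≡ true → X b ≡ true → a ≡ b) →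
    χ (anyBelow M X) ≡ Σ M (λ p → χ (X p))
  χ-anyBelow zero    X unique = refl
  χ-anyBelow (suc M) X unique with X M in XM
  ... | true  = begin
    χ (anyBelow M X ∨ true)                ≡⟨ cong χ (∨-zeroʳ (anyBelow M X)) ⟩
    1ℚ                                     ≡⟨ ℚP.+-identityˡ 1ℚ ⟨
    0ℚ ℚ.+ 1ℚ                              ≡⟨ cong (ℚ._+ 1ℚ) (Σ-zero M others) ⟨
    Σ M (λ p → χ (X p)) ℚ.+ 1ℚ             ∎
    where
    others : ∀ p → p < M → χ (X p) ≡ 0ℚ
    others p p<M = cong χ (¬true⇒false (λ Xp → ℕP.<-irrefl (unique p M (ℕP.m<n⇒m<1+n p<M) (ℕP.n<1+n M) Xp XM) p<M))
  ... | false = begin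
    χ (anyBelow M X ∨ false)               ≡⟨ cong χ (∨-identityʳ (anyBelow M X)) ⟩
    χ (anyBelow M X)                       ≡⟨ χ-anyBelow M X (λ a b a< b< → unique a b (ℕP.m<n⇒m<1+n a<) (ℕP.m<n⇒m<1+n b<)) ⟩
    Σ M (λ p → χ (X p))                    ≡⟨ ℚP.+-identityʳ _ ⟨
    Σ M (λ p → χ (X p)) ℚ.+ 0ℚ             ∎

  Σ-point : ∀ n v (G : ℕ → ℚ) → v < n → Σ n (λ r → χ (v ≡ᵇ r) ℚ.* G r) ≡ G v
  Σ-point (suc n) v G v<1+n with ℕP.<-cmp v n
  ... | tri< v<n _ _ = begin
    Σ n (λ r → χ (v ≡ᵇ r) ℚ.* G r) ℚ.+ χ (v ≡ᵇ n) ℚ.* G n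
      ≡⟨ cong₂ ℚ._+_ (Σ-point n v G v<n) (cong (λ z → χ z ℚ.* G n) (≢⇒≡ᵇ-false v n (λ e → ℕP.<-irrefl e v<n))) ⟩
    G v ℚ.+ 0ℚ ℚ.* G n                     ≡⟨ cong (G v ℚ.+_) (ℚP.*-zeroˡ (G n)) ⟩
    G v ℚ.+ 0ℚ                             ≡⟨ ℚP.+-identityʳ (G v) ⟩
    G v                                    ∎
  ... | tri≈ _ refl _ = begin
    Σ v (λ r → χ (v ≡ᵇ r) ℚ.* G r) ℚ.+ χ (v ≡ᵇ v) ℚ.* G v
      ≡⟨ cong₂ ℚ._+_ (Σ-zero v (λ r r<v → trans (cong (λ z → χ z ℚ.* G r) (≢⇒≡ᵇ-false v r (λ e → ℕP.<-irrefl (sym e) r<v)))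
                                                 (ℚP.*-zeroˡ (G r))))
                     (cong (λ z → χ z ℚ.* G v) (≡ᵇ-refl v)) ⟩
    0ℚ ℚ.+ 1ℚ ℚ.* G v                      ≡⟨ ℚP.+-identityˡ _ ⟩
    1ℚ ℚ.* G v                             ≡⟨ ℚP.*-identityˡ (G v) ⟩
    G v                                    ∎
  ... | tri> _ _ n<v = contradiction (ℕP.≤-pred v<1+n) (ℕP.<⇒≱ n<v)

  Σ-by-value : ∀ M R (A : ℕ → Bool) (f : ℕ → ℕ) (G : ℕ → ℚ) → (∀ p → p < M → f p ≤ R) →
    Σ M (λ p → χ (A p) ℚ.* G (f p)) ≡ Σ (suc R) (λ r → ι (countBelow M (λ p → A p ∧ (f p ≡ᵇ r))) ℚ.* G r)
  Σ-by-value M R A f G f≤R = begin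
    Σ M (λ p → χ (A p) ℚ.* G (f p))
      ≡⟨ Σ-cong M (λ p p<M → cong (χ (A p) ℚ.*_) (sym (Σ-point (suc R) (f p) G (s≤s (f≤R p p<M))))) ⟩
    Σ M (λ p → χ (A p) ℚ.* Σ (suc R) (λ r → χ (f p ≡ᵇ r) ℚ.* G r))
      ≡⟨ Σ-cong M (λ p _ → trans (Σ-*ˡ (suc R) (χ (A p)) _)
           (Σ-cong (suc R) (λ r _ → trans (sym (ℚP.*-assoc (χ (A p)) _ _)) (cong (ℚ._* G r) (sym (χ-∧ (A p) (f p ≡ᵇ r))))))) ⟩
    Σ M (λ p → Σ (suc R) (λ r → χ (A p ∧ (f p ≡ᵇ r)) ℚ.* G r))
      ≡⟨ Σ-swap M (suc R) _ ⟩
    Σ (suc R) (λ r → Σ M (λ p → χ (A p ∧ (f p ≡ᵇ r)) ℚ.* G r))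
      ≡⟨ Σ-cong (suc R) (λ r _ → trans (sym (Σ-*ʳ M (G r) _)) (cong (ℚ._* G r) (sym (ι-countBelow M _)))) ⟩
    Σ (suc R) (λ r → ι (countBelow M (λ p → A p ∧ (f p ≡ᵇ r))) ℚ.* G r) ∎

  Σ-2^suc : ∀ M f → Σ (2 ^ suc M) f ≡ Σ (2 ^ M) f ℚ.+ Σ (2 ^ M) (λ q → f (q + 2 ^ M))
  Σ-2^suc M f = begin
    Σ (2 ^ suc M) f                                   ≡⟨ cong (λ z → Σ (2 ^ M + z) f) (ℕP.+-identityʳ (2 ^ M)) ⟩
    Σ (2 ^ M + 2 ^ M) f                               ≡⟨ Σ-split (2 ^ M) (2 ^ M) f ⟩
    Σ (2 ^ M) f ℚ.+ Σ (2 ^ M) (λ q → f (2 ^ M + q))   ≡⟨ cong (Σ (2 ^ M) f ℚ.+_) (Σ-cong (2 ^ M) (λ q _ → cong f (ℕP.+-comm (2 ^ M) q))) ⟩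
    Σ (2 ^ M) f ℚ.+ Σ (2 ^ M) (λ q → f (q + 2 ^ M))   ∎

  bit-+2^-below : ∀ M q → q < 2 ^ M → ∀ b → b < M → bit (q + 2 ^ M) b ≡ bit q b
  bit-+2^-below M q q< b b<M = trans (bit-+2^ M q (bit-beyond M q q< M ℕP.≤-refl) b)
    (trans (cong (bit q b ∨_) (≢⇒≡ᵇ-false b M (λ e → ℕP.<-irrefl e b<M))) (∨-identityʳ (bit q b)))

  bit-+2^-top : ∀ M q → q < 2 ^ M → bit (q + 2 ^ M) M ≡ true
  bit-+2^-top M q q< = trans (bit-+2^ M q (bit-beyond M q q< M ℕP.≤-refl) M)
    (trans (cong (bit q M ∨_) (≡ᵇ-refl M)) (∨-zeroʳ (bit q M)))

  -- Removing the element b is a bijection from the subsets of {0,…,M-1} containing b onto those that do not.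
  Σ-∈≡Σ-insert : ∀ M b → b < M → (P : ℕ → Bool) →
    Σ (2 ^ M) (λ q → χ (bit q b ∧ P q)) ≡ Σ (2 ^ M) (λ q → χ (not (bit q b) ∧ P (q + 2 ^ b)))
  Σ-∈≡Σ-insert (suc M) b b<1+M P with ℕP.<-cmp b M
  ... | tri< b<M _ _ = begin
    Σ (2 ^ suc M) (λ q → χ (bit q b ∧ P q))
      ≡⟨ Σ-2^suc M _ ⟩
    Σ (2 ^ M) (λ q → χ (bit q b ∧ P q)) ℚ.+ Σ (2 ^ M) (λ q → χ (bit (q + 2 ^ M) b ∧ P (q + 2 ^ M)))
      ≡⟨ cong₂ ℚ._+_ (Σ-∈≡Σ-insert M b b<M P) upper ⟩
    Σ (2 ^ M) (λ q → χ (not (bit q b) ∧ P (q + 2 ^ b))) ℚ.+ Σ (2 ^ M) (λ q → χ (not (bit (q + 2 ^ M) b) ∧ P (q + 2 ^ M + 2 ^ b)))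
      ≡⟨ Σ-2^suc M _ ⟨
    Σ (2 ^ suc M) (λ q → χ (not (bit q b) ∧ P (q + 2 ^ b))) ∎
    where
    upper : Σ (2 ^ M) (λ q → χ (bit (q + 2 ^ M) b ∧ P (q + 2 ^ M)))
          ≡ Σ (2 ^ M) (λ q → χ (not (bit (q + 2 ^ M) b) ∧ P (q + 2 ^ M + 2 ^ b)))
    upper = begin
      Σ (2 ^ M) (λ q → χ (bit (q + 2 ^ M) b ∧ P (q + 2 ^ M)))
        ≡⟨ Σ-cong (2 ^ M) (λ q q< → cong (λ z → χ (z ∧ P (q + 2 ^ M))) (bit-+2^-below M q q< b b<M)) ⟩
      Σ (2 ^ M) (λ q → χ (bit q b ∧ P (q + 2 ^ M)))
        ≡⟨ Σ-∈≡Σ-insert M b b<M (λ q → P (q + 2 ^ M)) ⟩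
      Σ (2 ^ M) (λ q → χ (not (bit q b) ∧ P (q + 2 ^ b + 2 ^ M)))
        ≡⟨ Σ-cong (2 ^ M) (λ q q< → cong₂ (λ z w → χ (not z ∧ P w)) (sym (bit-+2^-below M q q< b b<M)) (swap-summands q)) ⟩
      Σ (2 ^ M) (λ q → χ (not (bit (q + 2 ^ M) b) ∧ P (q + 2 ^ M + 2 ^ b))) ∎
      where
      swap-summands : ∀ q → q + 2 ^ b + 2 ^ M ≡ q + 2 ^ M + 2 ^ b
      swap-summands q = trans (ℕP.+-assoc q (2 ^ b) (2 ^ M))
        (trans (cong (q +_) (ℕP.+-comm (2 ^ b) (2 ^ M))) (sym (ℕP.+-assoc q (2 ^ M) (2 ^ b))))
  ... | tri≈ _ refl _ = begin
    Σ (2 ^ suc M) (λ q → χ (bit q M ∧ P q))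
      ≡⟨ Σ-2^suc M _ ⟩
    Σ (2 ^ M) (λ q → χ (bit q M ∧ P q)) ℚ.+ Σ (2 ^ M) (λ q → χ (bit (q + 2 ^ M) M ∧ P (q + 2 ^ M)))
      ≡⟨ cong₂ ℚ._+_ (Σ-zero (2 ^ M) (λ q q< → cong (λ z → χ (z ∧ P q)) (bit-beyond M q q< M ℕP.≤-refl)))
                     (Σ-cong (2 ^ M) (λ q q< → cong (λ z → χ (z ∧ P (q + 2 ^ M))) (bit-+2^-top M q q<))) ⟩
    0ℚ ℚ.+ Σ (2 ^ M) (λ q → χ (P (q + 2 ^ M)))
      ≡⟨ trans (ℚP.+-identityˡ _) (sym (ℚP.+-identityʳ (Σ (2 ^ M) (λ q → χ (P (q + 2 ^ M)))))) ⟩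
    Σ (2 ^ M) (λ q → χ (P (q + 2 ^ M))) ℚ.+ 0ℚ
      ≡⟨ cong₂ ℚ._+_ (Σ-cong (2 ^ M) (λ q q< → cong (λ z → χ (not z ∧ P (q + 2 ^ M))) (sym (bit-beyond M q q< M ℕP.≤-refl))))
                     (sym (Σ-zero (2 ^ M) (λ q q< → cong (λ z → χ (not z ∧ P (q + 2 ^ M + 2 ^ M))) (bit-+2^-top M q q<)))) ⟩
    Σ (2 ^ M) (λ q → χ (not (bit q M) ∧ P (q + 2 ^ M))) ℚ.+ Σ (2 ^ M) (λ q → χ (not (bit (q + 2 ^ M) M) ∧ P (q + 2 ^ M + 2 ^ M)))
      ≡⟨ Σ-2^suc M _ ⟨
    Σ (2 ^ suc M) (λ q → χ (not (bit q M) ∧ P (q + 2 ^ M))) ∎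
  ... | tri> _ _ M<b = contradiction (ℕP.≤-pred b<1+M) (ℕP.<⇒≱ M<b)

module Partitions where

  open BitSets
  open BoundedBool
  open import Data.Bool using (Bool; true; false; _∧_; _∨_; not)
  open import Data.Bool.Properties using (∨-zeroʳ; ∧-assoc)
  open import Data.Nat using (ℕ; _+_; _<_; _^_; _≡ᵇ_)
  open import Data.Product using (∃-syntax; _,_; _×_; proj₁; proj₂)
  open import Data.Sum using (_⊎_; inj₁; inj₂; [_,_])
  open import Data.Empty using (⊥; ⊥-elim)
  open import Relation.Binary.PropositionalEquality hiding ([_])

  record IsPartition (s p q : ℕ) : Set where
    field
      nonempty : ∀ b → b < 2 ^ s → bit q b ≡ true → ∃[ x ] (x < s × bit b x ≡ true)
      ⊆-ground : ∀ b → b < 2 ^ s → bit q b ≡ true → ∀ x → x < s → bit b x ≡ true → bit p x ≡ true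
      disjoint : ∀ b c → b < 2 ^ s → c < 2 ^ s → bit q b ≡ true → bit q c ≡ true → b ≢ c →
                 ∀ x → x < s → bit b x ≡ true → bit c x ≡ true → ⊥
      covers   : ∀ x → x < s → bit p x ≡ true → ∃[ b ] (b < 2 ^ s × bit q b ≡ true × bit b x ≡ true)
  open IsPartition

  nonemptyBlocksWithin pairwiseDisjoint coveredBy : (s p q : ℕ) → Bool
  nonemptyBlocksWithin s p q = allBelow (2 ^ s) (λ b → (b ∈ₛ q) ⇒ᵇ
    (anyBelow s (λ x → x ∈ₛ b) ∧ allBelow s (λ x → (x ∈ₛ b) ⇒ᵇ (x ∈ₛ p))))
  pairwiseDisjoint s p q = allBelow (2 ^ s) (λ b → allBelow (2 ^ s) (λ c →
    ((b ∈ₛ q) ∧ (c ∈ₛ q) ∧ not (b ≡ᵇ c)) ⇒ᵇ allBelow s (λ x → not ((x ∈ₛ b) ∧ (x ∈ₛ c)))))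
  coveredBy s p q = allBelow s (λ x → (x ∈ₛ p) ⇒ᵇ anyBelow (2 ^ s) (λ b → (b ∈ₛ q) ∧ (x ∈ₛ b)))

  isPartition⇒ : ∀ s p q → isPartition s p q ≡ true → IsPartition s p q
  isPartition⇒ s p q h = record
    { nonempty = λ b b< qb → anyBelow⇒ s (proj₁ (blocks b b< qb))
    ; ⊆-ground = λ b b< qb x x< bx → ⇒ᵇ-true⁻ (allBelow⇒ s (proj₂ (blocks b b< qb)) x x<) bx
    ; disjoint = λ b c b< c< qb qc b≢c x x< bx cx →
        true≢false (∧-true bx cx) (not-true⁻ (allBelow⇒ s (⇒ᵇ-true⁻ (allBelow⇒ (2 ^ s) (allBelow⇒ (2 ^ s) h₂ b b<) c c<)
                                                 (∧-true qb (∧-true qc (not-true (≢⇒≡ᵇ-false b c b≢c))))) x x<))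
    ; covers   = λ x x< px → let (b , b< , e) = anyBelow⇒ (2 ^ s) (⇒ᵇ-true⁻ (allBelow⇒ s h₃ x x<) px) in b , b< , ∧-true⁻ e
    }
    where
    h₁ = proj₁ (∧-true⁻ {nonemptyBlocksWithin s p q} h)
    h₂ = proj₁ (∧-true⁻ {pairwiseDisjoint s p q} (proj₂ (∧-true⁻ {nonemptyBlocksWithin s p q} h)))
    h₃ = proj₂ (∧-true⁻ {pairwiseDisjoint s p q} (proj₂ (∧-true⁻ {nonemptyBlocksWithin s p q} h)))
    blocks : ∀ b → b < 2 ^ s → bit q b ≡ true →
      anyBelow s (λ x → x ∈ₛ b) ≡ true × allBelow s (λ x → (x ∈ₛ b) ⇒ᵇ (x ∈ₛ p)) ≡ true
    blocks b b< qb = ∧-true⁻ (⇒ᵇ-true⁻ (allBelow⇒ (2 ^ s) h₁ b b<) qb)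

  ⇒isPartition : ∀ s p q → IsPartition s p q → isPartition s p q ≡ true
  ⇒isPartition s p q P = ∧-true (⇒allBelow (2 ^ s) blocks) (∧-true (⇒allBelow (2 ^ s) disjointness) covering)
    where
    blocks : ∀ b → b < 2 ^ s → ((b ∈ₛ q) ⇒ᵇ (anyBelow s (λ x → x ∈ₛ b) ∧ allBelow s (λ x → (x ∈ₛ b) ⇒ᵇ (x ∈ₛ p)))) ≡ true
    blocks b b< = ⇒ᵇ-true λ qb →
      ∧-true (let (x , x< , bx) = nonempty P b b< qb in ⇒anyBelow s x x< bx)
             (⇒allBelow s (λ x x< → ⇒ᵇ-true (⊆-ground P b b< qb x x<)))
    disjointness : ∀ b → b < 2 ^ s → allBelow (2 ^ s) (λ c → ((b ∈ₛ q) ∧ (c ∈ₛ q) ∧ not (b ≡ᵇ c)) ⇒ᵇ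
                                        allBelow s (λ x → not ((x ∈ₛ b) ∧ (x ∈ₛ c)))) ≡ true
    disjointness b b< = ⇒allBelow (2 ^ s) λ c c< → ⇒ᵇ-true λ e →
      let (qb , rest) = ∧-true⁻ e ; (qc , b≢ᵇc) = ∧-true⁻ rest in
      ⇒allBelow s λ x x< → not-true (¬true⇒false λ bcx →
        let (bx , cx) = ∧-true⁻ bcx in
        disjoint P b c b< c< qb qc (λ b≡c → true≢false (≡⇒≡ᵇ-true b c b≡c) (not-true⁻ b≢ᵇc)) x x< bx cx)
    covering : allBelow s (λ x → (x ∈ₛ p) ⇒ᵇ anyBelow (2 ^ s) (λ b → (b ∈ₛ q) ∧ (x ∈ₛ b))) ≡ true
    covering = ⇒allBelow s λ x x< → ⇒ᵇ-true λ px →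
      let (b , b< , qb , bx) = covers P x x< px in ⇒anyBelow (2 ^ s) b b< (∧-true qb bx)

  -- p is the union of the blocks of q.
  isPartition-ground-unique : ∀ s p p′ q → p < 2 ^ s → p′ < 2 ^ s →
    isPartition s p q ≡ true → isPartition s p′ q ≡ true → p ≡ p′
  isPartition-ground-unique s p p′ q p< p′< h h′ =
    bit-extensional s p p′ p< p′< (λ x x< → Bool-ext (via P P′ x x<) (via P′ P x x<))
    where
    P  = isPartition⇒ s p q h
    P′ = isPartition⇒ s p′ q h′
    via : ∀ {a b} → IsPartition s a q → IsPartition s b q → ∀ x → x < s → bit a x ≡ true → bit b x ≡ true
    via Pa Pb x x< ax = let (c , c< , qc , cx) = covers Pa x x< ax in ⊆-ground Pb c c< qc x x< cx

  nonemptySubset : ℕ → ℕ → ℕ → Bool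
  nonemptySubset s p B = anyBelow s (bit B) ∧ (B ⊆⟨ s ⟩ p)

  _∖⟨_⟩_ : ℕ → ℕ → ℕ → ℕ
  p ∖⟨ s ⟩ B = fromBits s (λ x → bit p x ∧ not (bit B x))

  -- Marking one block B of a partition of p is the same as choosing a nonempty B ⊆ p and a partition of p ∖ B.
  module MarkBlock (s p B q : ℕ) (B< : B < 2 ^ s) (q∌B : bit q B ≡ false) where

    q⁺ = q + 2 ^ B
    p⁻ = p ∖⟨ s ⟩ B

    bit-q⁺ : ∀ c → bit q⁺ c ≡ (bit q c ∨ (c ≡ᵇ B))
    bit-q⁺ = bit-+2^ B q q∌B

    bit-p⁻ : ∀ x → x < s → bit p⁻ x ≡ (bit p x ∧ not (bit B x))
    bit-p⁻ = bit-fromBits s (λ x → bit p x ∧ not (bit B x))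

    q⁺-cases : ∀ c → bit q⁺ c ≡ true → (bit q c ≡ true) ⊎ (c ≡ B)
    q⁺-cases c e with bit q c in qc
    ... | true  = inj₁ refl
    ... | false = inj₂ (≡ᵇ-true⁻ c B (trans (sym (trans (bit-q⁺ c) (cong (_∨ (c ≡ᵇ B)) qc))) e))

    q⊆q⁺ : ∀ c → bit q c ≡ true → bit q⁺ c ≡ true
    q⊆q⁺ c e = trans (bit-q⁺ c) (cong (_∨ (c ≡ᵇ B)) e)

    B∈q⁺ : bit q⁺ B ≡ true
    B∈q⁺ = trans (bit-q⁺ B) (trans (cong (bit q B ∨_) (≡ᵇ-refl B)) (∨-zeroʳ (bit q B)))

    p⁻⁻¹ : ∀ {x} → x < s → bit p⁻ x ≡ true → bit p x ≡ true × bit B x ≡ false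
    p⁻⁻¹ {x} x< e = let (px , ¬Bx) = ∧-true⁻ (trans (sym (bit-p⁻ x x<)) e) in px , not-true⁻ ¬Bx

    ∈p⁻ : ∀ {x} → x < s → bit p x ≡ true → bit B x ≡ false → bit p⁻ x ≡ true
    ∈p⁻ {x} x< px Bx = trans (bit-p⁻ x x<) (∧-true px (not-true Bx))

    unmark : IsPartition s p q⁺ → nonemptySubset s p B ≡ true × IsPartition s p⁻ q
    unmark P = ∧-true (let (x , x< , Bx) = nonempty P B B< B∈q⁺ in ⇒anyBelow s x x< Bx)
                      (⇒allBelow s (λ x x< → ⇒ᵇ-true (⊆-ground P B B< B∈q⁺ x x<)))
             , record
               { nonempty = λ b b< qb → nonempty P b b< (q⊆q⁺ b qb)
               ; ⊆-ground = λ b b< qb x x< bx → ∈p⁻ x< (⊆-ground P b b< (q⊆q⁺ b qb) x x< bx)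
                   (¬true⇒false (λ Bx → disjoint P b B b< B< (q⊆q⁺ b qb) B∈q⁺
                                          (λ b≡B → true≢false qb (trans (cong (bit q) b≡B) q∌B)) x x< bx Bx))
               ; disjoint = λ b c b< c< qb qc → disjoint P b c b< c< (q⊆q⁺ b qb) (q⊆q⁺ c qc)
               ; covers   = λ x x< p⁻x → let (px , Bx) = p⁻⁻¹ x< p⁻x ; (b , b< , q⁺b , bx) = covers P x x< px in
                   [ (λ qb → b , b< , qb , bx) , (λ b≡B → ⊥-elim (true≢false (trans (cong (λ z → bit z x) (sym b≡B)) bx) Bx)) ] (q⁺-cases b q⁺b)
               }

    module _ (B-ok : nonemptySubset s p B ≡ true) (P : IsPartition s p⁻ q) where

      B-nonempty : anyBelow s (bit B) ≡ true
      B-nonempty = proj₁ (∧-true⁻ B-ok)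

      B⊆p : ∀ x → x < s → bit B x ≡ true → bit p x ≡ true
      B⊆p x x< Bx = ⇒ᵇ-true⁻ (allBelow⇒ s (proj₂ (∧-true⁻ {anyBelow s (bit B)} B-ok)) x x<) Bx

      block-disjoint-B : ∀ b → b < 2 ^ s → bit q b ≡ true → ∀ x → x < s → bit b x ≡ true → bit B x ≡ false
      block-disjoint-B b b< qb x x< bx = proj₂ (p⁻⁻¹ x< (⊆-ground P b b< qb x x< bx))

      mark : IsPartition s p q⁺
      mark = record
        { nonempty = λ b b< q⁺b → [ (λ qb → nonempty P b b< qb) , (λ { refl → anyBelow⇒ s B-nonempty }) ] (q⁺-cases b q⁺b)
        ; ⊆-ground = λ b b< q⁺b x x< bx →
            [ (λ qb → proj₁ (p⁻⁻¹ x< (⊆-ground P b b< qb x x< bx))) , (λ { refl → B⊆p x x< bx }) ] (q⁺-cases b q⁺b)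
        ; disjoint = disjoint⁺
        ; covers   = covers⁺
        }
        where
        disjoint⁺ : ∀ b c → b < 2 ^ s → c < 2 ^ s → bit q⁺ b ≡ true → bit q⁺ c ≡ true → b ≢ c →
                    ∀ x → x < s → bit b x ≡ true → bit c x ≡ true → ⊥
        disjoint⁺ b c b< c< q⁺b q⁺c b≢c x x< bx cx with q⁺-cases b q⁺b | q⁺-cases c q⁺c
        ... | inj₁ qb   | inj₁ qc   = disjoint P b c b< c< qb qc b≢c x x< bx cx
        ... | inj₂ refl | inj₁ qc   = true≢false bx (block-disjoint-B c c< qc x x< cx)
        ... | inj₁ qb   | inj₂ refl = true≢false cx (block-disjoint-B b b< qb x x< bx)
        ... | inj₂ refl | inj₂ refl = b≢c refl
        covers⁺ : ∀ x → x < s → bit p x ≡ true → ∃[ b ] (b < 2 ^ s × bit q⁺ b ≡ true × bit b x ≡ true)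
        covers⁺ x x< px with bit B x in Bx
        ... | true  = B , B< , B∈q⁺ , Bx
        ... | false = let (b , b< , qb , bx) = covers P x x< (∈p⁻ x< px Bx) in b , b< , q⊆q⁺ b qb , bx

  partition-of-∖-∌ : ∀ s p B q → B < 2 ^ s → nonemptySubset s p B ≡ true → IsPartition s (p ∖⟨ s ⟩ B) q → bit q B ≡ false
  partition-of-∖-∌ s p B q B< B-ok P = ¬true⇒false λ qB →
    let (x , x< , Bx) = anyBelow⇒ s (proj₁ (∧-true⁻ B-ok)) in
    true≢false Bx (not-true⁻ (proj₂ (∧-true⁻ (trans (sym (bit-fromBits s _ x x<)) (⊆-ground P B B< qB x x< Bx)))))

  mark-block : ∀ s p B q k → B < 2 ^ s →
    (not (bit q B) ∧ (isPartition s p (q + 2 ^ B) ∧ (size (2 ^ s) (q + 2 ^ B) ≡ᵇ suc k)))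
    ≡ (nonemptySubset s p B ∧ (isPartition s (p ∖⟨ s ⟩ B) q ∧ (size (2 ^ s) q ≡ᵇ k)))
  mark-block s p B q k B< with bit q B in qB
  ... | true  = sym (¬true⇒false λ rhs →
                  let (B-ok , rest) = ∧-true⁻ {nonemptySubset s p B} rhs in
                  true≢false qB (partition-of-∖-∌ s p B q B< B-ok (isPartition⇒ s _ q (proj₁ (∧-true⁻ {isPartition s (p ∖⟨ s ⟩ B) q} rest)))))
  ... | false = begin
    isPartition s p q⁺ ∧ (size (2 ^ s) q⁺ ≡ᵇ suc k)
      ≡⟨ cong (λ z → isPartition s p q⁺ ∧ (z ≡ᵇ suc k)) size-q⁺ ⟩
    isPartition s p q⁺ ∧ (size (2 ^ s) q ≡ᵇ k)
      ≡⟨ cong (_∧ (size (2 ^ s) q ≡ᵇ k)) (Bool-ext unmark′ mark′) ⟩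
    (nonemptySubset s p B ∧ isPartition s (p ∖⟨ s ⟩ B) q) ∧ (size (2 ^ s) q ≡ᵇ k)
      ≡⟨ ∧-assoc (nonemptySubset s p B) _ _ ⟩
    nonemptySubset s p B ∧ (isPartition s (p ∖⟨ s ⟩ B) q ∧ (size (2 ^ s) q ≡ᵇ k)) ∎
    where
    open ≡-Reasoning
    open MarkBlock s p B q B< qB
    size-q⁺ : size (2 ^ s) q⁺ ≡ suc (size (2 ^ s) q)
    size-q⁺ = trans (countBelow-cong (2 ^ s) (λ c _ → bit-q⁺ c)) (countBelow-insert (2 ^ s) (bit q) B B< qB)
    unmark′ : isPartition s p q⁺ ≡ true → (nonemptySubset s p B ∧ isPartition s p⁻ q) ≡ true
    unmark′ h = let (B-ok , P) = unmark (isPartition⇒ s p q⁺ h) in ∧-true B-ok (⇒isPartition s p⁻ q P)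
    mark′ : (nonemptySubset s p B ∧ isPartition s p⁻ q) ≡ true → isPartition s p q⁺ ≡ true
    mark′ h = let (B-ok , I) = ∧-true⁻ {nonemptySubset s p B} h in ⇒isPartition s p q⁺ (mark B-ok (isPartition⇒ s p⁻ q I))

module CountingPartitions where

  open NatCast
  open FiniteSums
  open BoundedBool
  open IndicatorSums
  open Partitions
  open import Data.Bool using (Bool; true; false; _∧_; not)
  open import Data.Bool.Properties using (∧-identityʳ; ∧-zeroʳ)
  open import Data.Nat using (ℕ; suc; _+_; _^_; _≡ᵇ_)
  open import Data.Rational as ℚ using (ℚ; 1ℚ)
  import Data.Rational.Properties as ℚP
  open import Data.Product using (proj₂)
  open import Relation.Binary.PropositionalEquality
  open ≡-Reasoning

  #partitions : ℕ → ℕ → ℕ → ℕ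
  #partitions s p k = countBelow (2 ^ (2 ^ s)) (λ q → isPartition s p q ∧ (size (2 ^ s) q ≡ᵇ k))

  -- Double counting of partitions of p into k + 1 blocks with one block marked.
  #partitions-marked : ∀ s p k → ι (suc k) ℚ.* ι (#partitions s p (suc k))
    ≡ Σ (2 ^ s) (λ B → χ (nonemptySubset s p B) ℚ.* ι (#partitions s (p ∖⟨ s ⟩ B) k))
  #partitions-marked s p k = begin
    ι (suc k) ℚ.* ι (#partitions s p (suc k))
      ≡⟨ cong (ι (suc k) ℚ.*_) (ι-countBelow Q X) ⟩
    ι (suc k) ℚ.* Σ Q (λ q → χ (X q))
      ≡⟨ Σ-*ˡ Q (ι (suc k)) (λ q → χ (X q)) ⟩
    Σ Q (λ q → ι (suc k) ℚ.* χ (X q))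
      ≡⟨ Σ-cong Q (λ q _ → count-blocks q) ⟩
    Σ Q (λ q → Σ M (λ B → χ (bit q B ∧ X q)))
      ≡⟨ Σ-swap Q M _ ⟩
    Σ M (λ B → Σ Q (λ q → χ (bit q B ∧ X q)))
      ≡⟨ Σ-cong M (λ B B< → Σ-∈≡Σ-insert M B B< X) ⟩
    Σ M (λ B → Σ Q (λ q → χ (not (bit q B) ∧ X (q + 2 ^ B))))
      ≡⟨ Σ-cong M (λ B B< → Σ-cong Q (λ q _ → cong χ (mark-block s p B q k B<))) ⟩
    Σ M (λ B → Σ Q (λ q → χ (nonemptySubset s p B ∧ Y B q)))
      ≡⟨ Σ-cong M (λ B _ → factor B) ⟩
    Σ M (λ B → χ (nonemptySubset s p B) ℚ.* ι (#partitions s (p ∖⟨ s ⟩ B) k)) ∎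
    where
    M = 2 ^ s
    Q = 2 ^ M
    X : ℕ → Bool
    X q = isPartition s p q ∧ (size M q ≡ᵇ suc k)
    Y : ℕ → ℕ → Bool
    Y B q = isPartition s (p ∖⟨ s ⟩ B) q ∧ (size M q ≡ᵇ k)
    count-blocks : ∀ q → ι (suc k) ℚ.* χ (X q) ≡ Σ M (λ B → χ (bit q B ∧ X q))
    count-blocks q with X q in Xq
    ... | true  = begin
      ι (suc k) ℚ.* 1ℚ                  ≡⟨ ℚP.*-identityʳ (ι (suc k)) ⟩
      ι (suc k)                         ≡⟨ cong ι (≡ᵇ-true⁻ (size M q) (suc k) (proj₂ (∧-true⁻ {isPartition s p q} Xq))) ⟨
      ι (size M q)                      ≡⟨ ι-countBelow M (bit q) ⟩
      Σ M (λ B → χ (bit q B))           ≡⟨ Σ-cong M (λ B _ → cong χ (sym (∧-identityʳ (bit q B)))) ⟩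
      Σ M (λ B → χ (bit q B ∧ true))    ∎
    ... | false = trans (ℚP.*-zeroʳ (ι (suc k))) (sym (Σ-zero M (λ B _ → cong χ (∧-zeroʳ (bit q B)))))
    factor : ∀ B → Σ Q (λ q → χ (nonemptySubset s p B ∧ Y B q)) ≡ χ (nonemptySubset s p B) ℚ.* ι (#partitions s (p ∖⟨ s ⟩ B) k)
    factor B = begin
      Σ Q (λ q → χ (nonemptySubset s p B ∧ Y B q))            ≡⟨ Σ-cong Q (λ q _ → χ-∧ (nonemptySubset s p B) (Y B q)) ⟩
      Σ Q (λ q → χ (nonemptySubset s p B) ℚ.* χ (Y B q))      ≡⟨ Σ-*ˡ Q (χ (nonemptySubset s p B)) (λ q → χ (Y B q)) ⟨
      χ (nonemptySubset s p B) ℚ.* Σ Q (λ q → χ (Y B q))      ≡⟨ cong (χ (nonemptySubset s p B) ℚ.*_) (ι-countBelow Q (Y B)) ⟨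
      χ (nonemptySubset s p B) ℚ.* ι (#partitions s (p ∖⟨ s ⟩ B) k) ∎

module SubsetSums where

  open NatCast
  open FiniteSums
  open BitSets
  open BoundedBool
  open IndicatorSums
  open import Data.Bool using (true; false; _∧_)
  open import Data.Bool.Properties using (∧-identityʳ; ∧-zeroʳ)
  open import Data.Nat using (ℕ; zero; suc; _+_; _<_; _^_)
  import Data.Nat.Properties as ℕP
  open import Data.Nat.Combinatorics using (_C_; nCk+nC[k+1]≡[n+1]C[k+1]; k>n⇒nCk≡0)
  open import Data.Rational as ℚ using (ℚ; 0ℚ)
  import Data.Rational.Properties as ℚP
  open import Relation.Binary.PropositionalEquality
  open import Data.Rational.Solver
  open +-*-Solver
  open ≡-Reasoning

  binomialSum : ℕ → (ℕ → ℚ) → ℚ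
  binomialSum r F = Σ (suc r) (λ i → ι (r C i) ℚ.* F i)

  binomialSum-suc : ∀ r (F : ℕ → ℚ) → binomialSum (suc r) F ≡ binomialSum r F ℚ.+ binomialSum r (λ i → F (suc i))
  binomialSum-suc r F = begin
    binomialSum (suc r) F
      ≡⟨ Σ-shift (suc r) _ ⟩
    ι 1 ℚ.* F 0 ℚ.+ Σ (suc r) (λ i → ι (suc r C suc i) ℚ.* F (suc i))
      ≡⟨ cong (ι 1 ℚ.* F 0 ℚ.+_) (trans (Σ-cong (suc r) (λ i _ → pascal i)) (Σ-+ (suc r) _ _)) ⟩
    ι 1 ℚ.* F 0 ℚ.+ (A ℚ.+ (Σ r B ℚ.+ ι (r C suc r) ℚ.* F (suc r)))
      ≡⟨ cong (λ z → ι 1 ℚ.* F 0 ℚ.+ (A ℚ.+ (Σ r B ℚ.+ ι z ℚ.* F (suc r)))) (k>n⇒nCk≡0 (ℕP.n<1+n r)) ⟩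
    ι 1 ℚ.* F 0 ℚ.+ (A ℚ.+ (Σ r B ℚ.+ 0ℚ ℚ.* F (suc r)))
      ≡⟨ solve 4 (λ x a b f → x :+ (a :+ (b :+ con 0ℚ :* f)) := (x :+ b) :+ a) refl (ι 1 ℚ.* F 0) A (Σ r B) (F (suc r)) ⟩
    (ι 1 ℚ.* F 0 ℚ.+ Σ r B) ℚ.+ A
      ≡⟨ cong (ℚ._+ A) (Σ-shift r _) ⟨
    binomialSum r F ℚ.+ A ∎
    where
    A = binomialSum r (λ i → F (suc i))
    B = λ i → ι (r C suc i) ℚ.* F (suc i)
    pascal : ∀ i → ι (suc r C suc i) ℚ.* F (suc i) ≡ ι (r C i) ℚ.* F (suc i) ℚ.+ ι (r C suc i) ℚ.* F (suc i)
    pascal i = begin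
      ι (suc r C suc i) ℚ.* F (suc i)                           ≡⟨ cong (λ z → ι z ℚ.* F (suc i)) (nCk+nC[k+1]≡[n+1]C[k+1] r i) ⟨
      ι (r C i + r C suc i) ℚ.* F (suc i)                       ≡⟨ cong (ℚ._* F (suc i)) (ι-+ (r C i) (r C suc i)) ⟩
      (ι (r C i) ℚ.+ ι (r C suc i)) ℚ.* F (suc i)               ≡⟨ ℚP.*-distribʳ-+ (F (suc i)) (ι (r C i)) (ι (r C suc i)) ⟩
      ι (r C i) ℚ.* F (suc i) ℚ.+ ι (r C suc i) ℚ.* F (suc i)   ∎

  -- Grouping the subsets of p by their size: there are C(|p|, i) of size i.
  Σ-subsets-by-size : ∀ s p (F : ℕ → ℚ) →
    Σ (2 ^ s) (λ B → χ (B ⊆⟨ s ⟩ p) ℚ.* F (size s B)) ≡ binomialSum (size s p) F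
  Σ-subsets-by-size zero    p F = refl
  Σ-subsets-by-size (suc s) p F = begin
    Σ (2 ^ suc s) (λ B → χ (B ⊆⟨ suc s ⟩ p) ℚ.* F (size (suc s) B))
      ≡⟨ Σ-2^suc s _ ⟩
    Σ (2 ^ s) (λ B → χ (B ⊆⟨ suc s ⟩ p) ℚ.* F (size (suc s) B)) ℚ.+
      Σ (2 ^ s) (λ B → χ ((B + 2 ^ s) ⊆⟨ suc s ⟩ p) ℚ.* F (size (suc s) (B + 2 ^ s)))
      ≡⟨ cong₂ ℚ._+_ (Σ-cong (2 ^ s) (λ B B< → cong₂ (λ u v → χ u ℚ.* F v) (⊆-without-s B B<) (size-without-s B B<)))
                     (Σ-cong (2 ^ s) (λ B B< → cong₂ (λ u v → χ u ℚ.* F v) (⊆-with-s B B<) (size-with-s B B<))) ⟩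
    Σ (2 ^ s) (λ B → χ (B ⊆⟨ s ⟩ p) ℚ.* F (size s B)) ℚ.+
      Σ (2 ^ s) (λ B → χ ((B ⊆⟨ s ⟩ p) ∧ bit p s) ℚ.* F (suc (size s B)))
      ≡⟨ cong (ℚ._+ Σ (2 ^ s) (λ B → χ ((B ⊆⟨ s ⟩ p) ∧ bit p s) ℚ.* F (suc (size s B)))) (Σ-subsets-by-size s p F) ⟩
    binomialSum (size s p) F ℚ.+ Σ (2 ^ s) (λ B → χ ((B ⊆⟨ s ⟩ p) ∧ bit p s) ℚ.* F (suc (size s B)))
      ≡⟨ last-element (bit p s) refl ⟩
    binomialSum (size (suc s) p) F ∎
    where
    ⊆-without-s : ∀ B → B < 2 ^ s → B ⊆⟨ suc s ⟩ p ≡ B ⊆⟨ s ⟩ p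
    ⊆-without-s B B< = trans (cong (λ z → (B ⊆⟨ s ⟩ p) ∧ (z ⇒ᵇ bit p s)) (bit-beyond s B B< s ℕP.≤-refl)) (∧-identityʳ (B ⊆⟨ s ⟩ p))
    size-without-s : ∀ B → B < 2 ^ s → size (suc s) B ≡ size s B
    size-without-s B B< = trans (cong (λ z → size s B + fromBool z) (bit-beyond s B B< s ℕP.≤-refl)) (ℕP.+-identityʳ (size s B))
    ⊆-with-s : ∀ B → B < 2 ^ s → (B + 2 ^ s) ⊆⟨ suc s ⟩ p ≡ ((B ⊆⟨ s ⟩ p) ∧ bit p s)
    ⊆-with-s B B< = cong₂ (λ u v → u ∧ (v ⇒ᵇ bit p s))
      (allBelow-cong s (λ x x< → cong (_⇒ᵇ bit p x) (bit-+2^-below s B B< x x<))) (bit-+2^-top s B B<)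
    size-with-s : ∀ B → B < 2 ^ s → size (suc s) (B + 2 ^ s) ≡ suc (size s B)
    size-with-s B B< = trans (cong₂ (λ u v → u + fromBool v) (countBelow-cong s (λ x x< → bit-+2^-below s B B< x x<)) (bit-+2^-top s B B<))
                             (ℕP.+-comm (size s B) 1)
    last-element : ∀ b → bit p s ≡ b →
      binomialSum (size s p) F ℚ.+ Σ (2 ^ s) (λ B → χ ((B ⊆⟨ s ⟩ p) ∧ b) ℚ.* F (suc (size s B))) ≡ binomialSum (size (suc s) p) F
    last-element false ps = begin
      binomialSum (size s p) F ℚ.+ Σ (2 ^ s) (λ B → χ ((B ⊆⟨ s ⟩ p) ∧ false) ℚ.* F (suc (size s B)))
        ≡⟨ cong (binomialSum (size s p) F ℚ.+_) (Σ-zero (2 ^ s) (λ B _ →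
             trans (cong (λ z → χ z ℚ.* F (suc (size s B))) (∧-zeroʳ (B ⊆⟨ s ⟩ p))) (ℚP.*-zeroˡ (F (suc (size s B)))))) ⟩
      binomialSum (size s p) F ℚ.+ 0ℚ
        ≡⟨ ℚP.+-identityʳ _ ⟩
      binomialSum (size s p) F
        ≡⟨ cong (λ z → binomialSum z F) (trans (cong (λ z → size s p + fromBool z) ps) (ℕP.+-identityʳ (size s p))) ⟨
      binomialSum (size (suc s) p) F ∎
    last-element true ps = begin
      binomialSum (size s p) F ℚ.+ Σ (2 ^ s) (λ B → χ ((B ⊆⟨ s ⟩ p) ∧ true) ℚ.* F (suc (size s B)))
        ≡⟨ cong (binomialSum (size s p) F ℚ.+_)
             (trans (Σ-cong (2 ^ s) (λ B _ → cong (λ z → χ z ℚ.* F (suc (size s B))) (∧-identityʳ (B ⊆⟨ s ⟩ p))))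
                                                       (Σ-subsets-by-size s p (λ i → F (suc i)))) ⟩
      binomialSum (size s p) F ℚ.+ binomialSum (size s p) (λ i → F (suc i))
        ≡⟨ binomialSum-suc (size s p) F ⟨
      binomialSum (suc (size s p)) F
        ≡⟨ cong (λ z → binomialSum z F) (trans (cong (λ z → size s p + fromBool z) ps) (ℕP.+-comm (size s p) 1)) ⟨
      binomialSum (size (suc s) p) F ∎

module StirlingFormula where

  open NatCast
  open FiniteSums
  open PowerSeries
  open BitSets
  open BoundedBool
  open IndicatorSums
  open Partitions
  open CountingPartitions
  open SubsetSums
  open import Data.Bool using (Bool; true; false; _∧_; not)
  open import Data.Bool.Properties using (∧-identityʳ; ∧-zeroʳ)
  open import Data.Nat using (ℕ; zero; suc; _+_; _*_; _≤_; _<_; _∸_; _^_; _≡ᵇ_; _!)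
  import Data.Nat.Properties as ℕP
  open import Data.Nat.DivMod using (m/n*n≡m)
  open import Data.Nat.Combinatorics using (_C_; nCk≡n!/k![n-k]!; k![n∸k]!∣n!)
  open import Data.Rational as ℚ using (ℚ; 0ℚ; 1ℚ)
  import Data.Rational.Properties as ℚP
  open import Data.Product using (_,_)
  open import Data.Empty using (⊥; ⊥-elim)
  open import Relation.Binary.PropositionalEquality
  open import Data.Rational.Solver
  open +-*-Solver
  open ≡-Reasoning

  -- [t^r] (e^t - 1)^k / k!, so that S(r, k) = r! · stirlingCoeff k r.
  stirlingCoeff : ℕ → ℕ → ℚ
  stirlingCoeff k r = (expm1 ^ₛ k) r /! k

  stirlingCoeff-suc : ∀ k r → ι (suc k) ℚ.* stirlingCoeff (suc k) r ≡ Σ (suc r) (λ i → expm1 i ℚ.* stirlingCoeff k (r ∸ i))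
  stirlingCoeff-suc k r = begin
    ι (suc k) ℚ.* ((expm1 · (expm1 ^ₛ k)) r ℚ.* inv! (suc k))
      ≡⟨ solve 3 (λ a S u → a :* (S :* u) := S :* (a :* u)) refl (ι (suc k)) ((expm1 · (expm1 ^ₛ k)) r) (inv! (suc k)) ⟩
    (expm1 · (expm1 ^ₛ k)) r ℚ.* (ι (suc k) ℚ.* inv! (suc k))
      ≡⟨ cong₂ ℚ._*_ (·-coeff expm1 (expm1 ^ₛ k) r) (*-cancelˡ-ι (k !) {{k !≢0}} ι[k+1]/[k+1]!≡1/k!) ⟩
    Σ (suc r) (λ i → expm1 i ℚ.* (expm1 ^ₛ k) (r ∸ i)) ℚ.* inv! k
      ≡⟨ Σ-*ʳ (suc r) (inv! k) _ ⟩
    Σ (suc r) (λ i → expm1 i ℚ.* (expm1 ^ₛ k) (r ∸ i) ℚ.* inv! k)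
      ≡⟨ Σ-cong (suc r) (λ i _ → ℚP.*-assoc (expm1 i) ((expm1 ^ₛ k) (r ∸ i)) (inv! k)) ⟩
    Σ (suc r) (λ i → expm1 i ℚ.* stirlingCoeff k (r ∸ i)) ∎
    where
    open ℕP using (_!≢0)
    ι[k+1]/[k+1]!≡1/k! : ι (k !) ℚ.* (ι (suc k) ℚ.* inv! (suc k)) ≡ ι (k !) ℚ.* inv! k
    ι[k+1]/[k+1]!≡1/k! = begin
      ι (k !) ℚ.* (ι (suc k) ℚ.* inv! (suc k))   ≡⟨ solve 3 (λ a b u → a :* (b :* u) := u :* (b :* a)) refl (ι (k !)) (ι (suc k)) (inv! (suc k)) ⟩
      inv! (suc k) ℚ.* (ι (suc k) ℚ.* ι (k !))   ≡⟨ cong (inv! (suc k) ℚ.*_) (ι-* (suc k) (k !)) ⟨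
      inv! (suc k) ℚ.* ι (suc k !)               ≡⟨ inv!*n!≡1 (suc k) ⟩
      1ℚ                                         ≡⟨ inv!*n!≡1 k ⟨
      inv! k ℚ.* ι (k !)                         ≡⟨ ℚP.*-comm (inv! k) (ι (k !)) ⟩
      ι (k !) ℚ.* inv! k                         ∎

  C*!≡! : ∀ r i → i ≤ r → (r C i) * (i ! * (r ∸ i) !) ≡ r !
  C*!≡! r i i≤r = trans (cong (_* (i ! * (r ∸ i) !)) (nCk≡n!/k![n-k]! i≤r))
                        (m/n*n≡m {r !} {i ! * (r ∸ i) !} {{ℕP._!*_!≢0 i (r ∸ i)}} (k![n∸k]!∣n! i≤r))

  C*[r-i]!≡r!/i! : ∀ r i → i ≤ r → ι (r C i) ℚ.* ι ((r ∸ i) !) ≡ ι (r !) ℚ.* inv! i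
  C*[r-i]!≡r!/i! r i i≤r = *-cancelˡ-ι (i !) {{i !≢0}} (begin
    ι (i !) ℚ.* (ι (r C i) ℚ.* ι ((r ∸ i) !))    ≡⟨ ℚP.*-comm (ι (i !)) _ ⟩
    (ι (r C i) ℚ.* ι ((r ∸ i) !)) ℚ.* ι (i !)    ≡⟨ ℚP.*-assoc (ι (r C i)) _ _ ⟩
    ι (r C i) ℚ.* (ι ((r ∸ i) !) ℚ.* ι (i !))    ≡⟨ cong (ι (r C i) ℚ.*_) (ℚP.*-comm (ι ((r ∸ i) !)) (ι (i !))) ⟩
    ι (r C i) ℚ.* (ι (i !) ℚ.* ι ((r ∸ i) !))    ≡⟨ trans (ι-* (r C i) _) (cong (ι (r C i) ℚ.*_) (ι-* (i !) ((r ∸ i) !))) ⟨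
    ι ((r C i) * (i ! * (r ∸ i) !))              ≡⟨ cong ι (C*!≡! r i i≤r) ⟩
    ι (r !)                                      ≡⟨ ℚP.*-identityʳ (ι (r !)) ⟨
    ι (r !) ℚ.* 1ℚ                               ≡⟨ cong (ι (r !) ℚ.*_) (trans (ℚP.*-comm (ι (i !)) (inv! i)) (inv!*n!≡1 i)) ⟨
    ι (r !) ℚ.* (ι (i !) ℚ.* inv! i)             ≡⟨ solve 3 (λ a b c → a :* (b :* c) := b :* (a :* c)) refl (ι (r !)) (ι (i !)) (inv! i) ⟩
    ι (i !) ℚ.* (ι (r !) ℚ.* inv! i)             ∎)
    where open ℕP using (_!≢0)

  size≡0⇒≡0 : ∀ M q → q < 2 ^ M → size M q ≡ 0 → q ≡ 0
  size≡0⇒≡0 M q q< #q≡0 = bit-extensional M q 0 q< (ℕP.m^n>0 2 M)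
    (λ x x< → trans (countBelow≡0⇒ M (bit q) #q≡0 x x<) (sym (bit-empty x)))

  partition-without-blocks : ∀ s p q → q < 2 ^ (2 ^ s) →
    (isPartition s p q ∧ (size (2 ^ s) q ≡ᵇ 0)) ≡ ((0 ≡ᵇ q) ∧ (size s p ≡ᵇ 0))
  partition-without-blocks s p q q< = Bool-ext ⇒empty ⇐empty
    where
    ∉∅ : ∀ b → bit 0 b ≡ true → ⊥
    ∉∅ b e = true≢false e (bit-empty b)
    ⇒empty : (isPartition s p q ∧ (size (2 ^ s) q ≡ᵇ 0)) ≡ true → ((0 ≡ᵇ q) ∧ (size s p ≡ᵇ 0)) ≡ true
    ⇒empty h with ∧-true⁻ {isPartition s p q} h
    ... | I , #q≡ᵇ0 with size≡0⇒≡0 (2 ^ s) q q< (≡ᵇ-true⁻ _ 0 #q≡ᵇ0)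
    ... | refl = ≡⇒≡ᵇ-true _ 0 (countBelow-none s (bit p) (λ x x< → ¬true⇒false (λ px →
                   let (b , _ , qb , _) = IsPartition.covers (isPartition⇒ s p 0 I) x x< px in ∉∅ b qb)))
    ⇐empty : ((0 ≡ᵇ q) ∧ (size s p ≡ᵇ 0)) ≡ true → (isPartition s p q ∧ (size (2 ^ s) q ≡ᵇ 0)) ≡ true
    ⇐empty h with ∧-true⁻ {0 ≡ᵇ q} h
    ... | 0≡ᵇq , #p≡ᵇ0 with ≡ᵇ-true⁻ 0 q 0≡ᵇq
    ... | refl = ∧-true (⇒isPartition s p 0 (record
                   { nonempty = λ b _ e → ⊥-elim (∉∅ b e)
                   ; ⊆-ground = λ b _ e → ⊥-elim (∉∅ b e)
                   ; disjoint = λ b _ _ _ e → ⊥-elim (∉∅ b e)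
                   ; covers   = λ x x< px → ⊥-elim (true≢false px (countBelow≡0⇒ s (bit p) (≡ᵇ-true⁻ _ 0 #p≡ᵇ0) x x<)) }))
                 (≡⇒≡ᵇ-true _ 0 (countBelow-none (2 ^ s) (bit 0) (λ x _ → bit-empty x)))

  #partitions-zero : ∀ s p → ι (#partitions s p 0) ≡ ι (size s p !) ℚ.* stirlingCoeff 0 (size s p)
  #partitions-zero s p = begin
    ι (#partitions s p 0)                                   ≡⟨ ι-countBelow Q _ ⟩
    Σ Q (λ q → χ (isPartition s p q ∧ (size (2 ^ s) q ≡ᵇ 0)))
                                                            ≡⟨ Σ-cong Q (λ q q< → trans (cong χ (partition-without-blocks s p q q<)) (χ-∧ (0 ≡ᵇ q) _)) ⟩
    Σ Q (λ q → χ (0 ≡ᵇ q) ℚ.* χ (size s p ≡ᵇ 0))           ≡⟨ Σ-point Q 0 (λ _ → χ (size s p ≡ᵇ 0)) (ℕP.m^n>0 2 (2 ^ s)) ⟩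
    χ (size s p ≡ᵇ 0)                                       ≡⟨ empty-only (size s p) ⟩
    ι (size s p !) ℚ.* stirlingCoeff 0 (size s p)           ∎
    where
    Q = 2 ^ (2 ^ s)
    empty-only : ∀ r → χ (r ≡ᵇ 0) ≡ ι (r !) ℚ.* stirlingCoeff 0 r
    empty-only zero    = refl
    empty-only (suc r) = sym (trans (cong (ι (suc r !) ℚ.*_) (ℚP.*-zeroˡ (inv! 0))) (ℚP.*-zeroʳ (ι (suc r !))))

  size-∖ : ∀ s p B → B ⊆⟨ s ⟩ p ≡ true → size s (p ∖⟨ s ⟩ B) ≡ size s p ∸ size s B
  size-∖ s p B B⊆p = begin
    size s (p ∖⟨ s ⟩ B)                                                   ≡⟨ countBelow-cong s (bit-fromBits s _) ⟩
    countBelow s (λ x → bit p x ∧ not (bit B x))                          ≡⟨ ℕP.m+n∸n≡m _ (size s B) ⟨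
    countBelow s (λ x → bit p x ∧ not (bit B x)) + size s B ∸ size s B    ≡⟨ cong (_∸ size s B) (countBelow-difference s (bit p) (bit B)
                                                                              (λ x x< → ⇒ᵇ-true⁻ (allBelow⇒ s B⊆p x x<))) ⟩
    size s p ∸ size s B                                                   ∎

  -- (k+1) S(r, k+1) = Σ_{i ≥ 1} C(r, i) S(r - i, k) matches the coefficient recurrence stirlingCoeff-suc.
  #partitions≡ : ∀ k s p → ι (#partitions s p k) ≡ ι (size s p !) ℚ.* stirlingCoeff k (size s p)
  #partitions≡ zero    s p = #partitions-zero s p
  #partitions≡ (suc k) s p = *-cancelˡ-ι (suc k) (begin
    ι (suc k) ℚ.* ι (#partitions s p (suc k))
      ≡⟨ #partitions-marked s p k ⟩
    Σ (2 ^ s) (λ B → χ (nonemptySubset s p B) ℚ.* ι (#partitions s (p ∖⟨ s ⟩ B) k))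
      ≡⟨ Σ-cong (2 ^ s) (λ B _ → remove-block B) ⟩
    Σ (2 ^ s) (λ B → χ (B ⊆⟨ s ⟩ p) ℚ.* F (size s B))
      ≡⟨ Σ-subsets-by-size s p F ⟩
    binomialSum r F
      ≡⟨ Σ-cong (suc r) (λ i i≤r → binomial-term i (ℕP.≤-pred i≤r)) ⟩
    Σ (suc r) (λ i → ι (r !) ℚ.* (expm1 i ℚ.* stirlingCoeff k (r ∸ i)))
      ≡⟨ Σ-*ˡ (suc r) (ι (r !)) _ ⟨
    ι (r !) ℚ.* Σ (suc r) (λ i → expm1 i ℚ.* stirlingCoeff k (r ∸ i))
      ≡⟨ cong (ι (r !) ℚ.*_) (stirlingCoeff-suc k r) ⟨
    ι (r !) ℚ.* (ι (suc k) ℚ.* stirlingCoeff (suc k) r)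
      ≡⟨ solve 3 (λ a b c → a :* (b :* c) := b :* (a :* c)) refl (ι (r !)) (ι (suc k)) (stirlingCoeff (suc k) r) ⟩
    ι (suc k) ℚ.* (ι (r !) ℚ.* stirlingCoeff (suc k) r) ∎)
    where
    r = size s p
    F : ℕ → ℚ
    F i = χ (not (i ≡ᵇ 0)) ℚ.* (ι ((r ∸ i) !) ℚ.* stirlingCoeff k (r ∸ i))
    remove-block : ∀ B → χ (nonemptySubset s p B) ℚ.* ι (#partitions s (p ∖⟨ s ⟩ B) k) ≡ χ (B ⊆⟨ s ⟩ p) ℚ.* F (size s B)
    remove-block B with B ⊆⟨ s ⟩ p in B⊆p
    ... | false = begin
      χ (anyBelow s (bit B) ∧ false) ℚ.* ι (#partitions s (p ∖⟨ s ⟩ B) k)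
                                                                            ≡⟨ cong (λ z → χ z ℚ.* ι (#partitions s (p ∖⟨ s ⟩ B) k)) (∧-zeroʳ (anyBelow s (bit B))) ⟩
      0ℚ ℚ.* ι (#partitions s (p ∖⟨ s ⟩ B) k)                               ≡⟨ ℚP.*-zeroˡ (ι (#partitions s (p ∖⟨ s ⟩ B) k)) ⟩
      0ℚ                                                                    ≡⟨ ℚP.*-zeroˡ (F (size s B)) ⟨
      0ℚ ℚ.* F (size s B)                                                   ∎
    ... | true  = begin
      χ (anyBelow s (bit B) ∧ true) ℚ.* ι (#partitions s (p ∖⟨ s ⟩ B) k)
        ≡⟨ cong₂ ℚ._*_ (cong χ (trans (∧-identityʳ (anyBelow s (bit B))) (anyBelow≡nonzero s (bit B)))) (#partitions≡ k s (p ∖⟨ s ⟩ B)) ⟩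
      χ (not (size s B ≡ᵇ 0)) ℚ.* (ι (size s (p ∖⟨ s ⟩ B) !) ℚ.* stirlingCoeff k (size s (p ∖⟨ s ⟩ B)))
        ≡⟨ cong (λ z → χ (not (size s B ≡ᵇ 0)) ℚ.* (ι (z !) ℚ.* stirlingCoeff k z)) (size-∖ s p B B⊆p) ⟩
      F (size s B)
        ≡⟨ ℚP.*-identityˡ _ ⟨
      1ℚ ℚ.* F (size s B) ∎
    binomial-term : ∀ i → i ≤ r → ι (r C i) ℚ.* F i ≡ ι (r !) ℚ.* (expm1 i ℚ.* stirlingCoeff k (r ∸ i))
    binomial-term zero    _   = begin
      ι (r C 0) ℚ.* (0ℚ ℚ.* (ι (r !) ℚ.* stirlingCoeff k r))   ≡⟨ cong (ι (r C 0) ℚ.*_) (ℚP.*-zeroˡ (ι (r !) ℚ.* stirlingCoeff k r)) ⟩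
      ι (r C 0) ℚ.* 0ℚ                 ≡⟨ ℚP.*-zeroʳ (ι (r C 0)) ⟩
      0ℚ                               ≡⟨ ℚP.*-zeroʳ (ι (r !)) ⟨
      ι (r !) ℚ.* 0ℚ                   ≡⟨ cong (ι (r !) ℚ.*_) (ℚP.*-zeroˡ (stirlingCoeff k r)) ⟨
      ι (r !) ℚ.* (0ℚ ℚ.* stirlingCoeff k r) ∎
    binomial-term i@(suc _) i≤r = begin
      ι (r C i) ℚ.* (1ℚ ℚ.* (ι ((r ∸ i) !) ℚ.* c))   ≡⟨ cong (ι (r C i) ℚ.*_) (ℚP.*-identityˡ _) ⟩
      ι (r C i) ℚ.* (ι ((r ∸ i) !) ℚ.* c)            ≡⟨ ℚP.*-assoc (ι (r C i)) _ c ⟨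
      ι (r C i) ℚ.* ι ((r ∸ i) !) ℚ.* c              ≡⟨ cong (ℚ._* c) (C*[r-i]!≡r!/i! r i i≤r) ⟩
      ι (r !) ℚ.* inv! i ℚ.* c                       ≡⟨ ℚP.*-assoc (ι (r !)) (inv! i) c ⟩
      ι (r !) ℚ.* (inv! i ℚ.* c)                     ∎
      where c = stirlingCoeff k (r ∸ i)

module HigherOrderStirling where

  open NatCast
  open FiniteSums
  open PowerSeries
  open BitSets
  open BoundedBool
  open IndicatorSums
  open Partitions
  open CountingPartitions
  open StirlingFormula
  open import Data.Bool using (Bool; _∧_)
  open import Data.Nat as ℕ using (ℕ; zero; suc; _≤_; _<_; s≤s; z≤n; _^_; _≡ᵇ_; _!)
  import Data.Nat.Properties as ℕP
  open import Data.Rational as ℚ using (ℚ; 0ℚ; 1ℚ)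
  import Data.Rational.Properties as ℚP
  open import Data.Product using (proj₂)
  open import Relation.Binary.PropositionalEquality
  open import Data.Rational.Solver
  open +-*-Solver
  open ≡-Reasoning

  minusOne-E-0 : ∀ j → minusOne (E j) 0 ≡ 0ℚ
  minusOne-E-0 zero    = refl
  minusOne-E-0 (suc j) = refl

  n≤card : ∀ n i → n ≤ card n i
  n≤card n zero    = ℕP.≤-refl
  n≤card n (suc i) = ℕP.≤-trans (n≤card n i) (ℕP.<⇒≤ (n<2^n (card n i)))
    where
    n<2^n : ∀ n → n < 2 ^ n
    n<2^n zero    = s≤s z≤n
    n<2^n (suc n) = ℕP.<-≤-trans (s≤s (n<2^n n))
      (subst (suc (2 ^ n) ≤_) (cong (2 ^ n ℕ.+_) (sym (ℕP.+-identityʳ (2 ^ n)))) (ℕP.+-monoˡ-≤ (2 ^ n) (ℕP.m^n>0 2 n)))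

  -- Each element of ℘_n^{(j+2)} partitions exactly one p ∈ ℘_n^{(j+1)}; group them by that p and then by |p|.
  S⁽⁾-by-parent : ∀ j n k → ι (S⁽ suc (suc j) ⁾ n k)
    ≡ Σ (suc (card n (suc j))) (λ r → ι (S⁽ suc j ⁾ n r) ℚ.* (ι (r !) ℚ.* stirlingCoeff k r))
  S⁽⁾-by-parent j n k = begin
    ι (countBelow Q (λ q → anyBelow M (λ p → ℘ n j p ∧ isPartition s p q) ∧ (size M q ≡ᵇ k)))
      ≡⟨ ι-countBelow Q _ ⟩
    Σ Q (λ q → χ (anyBelow M (λ p → ℘ n j p ∧ isPartition s p q) ∧ (size M q ≡ᵇ k)))
      ≡⟨ Σ-cong Q (λ q _ → unique-parent q) ⟩
    Σ Q (λ q → Σ M (λ p → χ (℘ n j p) ℚ.* χ (isPartition s p q ∧ (size M q ≡ᵇ k))))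
      ≡⟨ Σ-swap Q M _ ⟩
    Σ M (λ p → Σ Q (λ q → χ (℘ n j p) ℚ.* χ (isPartition s p q ∧ (size M q ≡ᵇ k))))
      ≡⟨ Σ-cong M (λ p _ → trans (sym (Σ-*ˡ Q (χ (℘ n j p)) _)) (cong (χ (℘ n j p) ℚ.*_) (sym (ι-countBelow Q _)))) ⟩
    Σ M (λ p → χ (℘ n j p) ℚ.* ι (#partitions s p k))
      ≡⟨ Σ-cong M (λ p _ → cong (χ (℘ n j p) ℚ.*_) (#partitions≡ k s p)) ⟩
    Σ M (λ p → χ (℘ n j p) ℚ.* (ι (size s p !) ℚ.* stirlingCoeff k (size s p)))
      ≡⟨ Σ-by-value M s (℘ n j) (size s) (λ r → ι (r !) ℚ.* stirlingCoeff k r) (λ p _ → countBelow≤ s (bit p)) ⟩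
    Σ (suc s) (λ r → ι (S⁽ suc j ⁾ n r) ℚ.* (ι (r !) ℚ.* stirlingCoeff k r)) ∎
    where
    s = card n (suc j)
    M = 2 ^ s
    Q = 2 ^ M
    unique-parent : ∀ q → χ (anyBelow M (λ p → ℘ n j p ∧ isPartition s p q) ∧ (size M q ≡ᵇ k))
                        ≡ Σ M (λ p → χ (℘ n j p) ℚ.* χ (isPartition s p q ∧ (size M q ≡ᵇ k)))
    unique-parent q = begin
      χ (anyBelow M (λ p → ℘ n j p ∧ isPartition s p q) ∧ Z)
        ≡⟨ χ-∧ (anyBelow M (λ p → ℘ n j p ∧ isPartition s p q)) Z ⟩
      χ (anyBelow M (λ p → ℘ n j p ∧ isPartition s p q)) ℚ.* χ Z
        ≡⟨ cong (ℚ._* χ Z) (χ-anyBelow M _ (λ a b a< b< ea eb →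
             isPartition-ground-unique s a b q a< b< (proj₂ (∧-true⁻ {℘ n j a} ea)) (proj₂ (∧-true⁻ {℘ n j b} eb)))) ⟩
      Σ M (λ p → χ (℘ n j p ∧ isPartition s p q)) ℚ.* χ Z
        ≡⟨ Σ-*ʳ M (χ Z) _ ⟩
      Σ M (λ p → χ (℘ n j p ∧ isPartition s p q) ℚ.* χ Z)
        ≡⟨ Σ-cong M (λ p _ → trans (cong (ℚ._* χ Z) (χ-∧ (℘ n j p) _))
                              (trans (ℚP.*-assoc (χ (℘ n j p)) _ (χ Z)) (cong (χ (℘ n j p) ℚ.*_) (sym (χ-∧ (isPartition s p q) Z))))) ⟩
      Σ M (λ p → χ (℘ n j p) ℚ.* χ (isPartition s p q ∧ Z)) ∎
      where Z = size M q ≡ᵇ k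

  S⁽⁾-egf : ∀ j n k → ι (S⁽ suc j ⁾ n k) ℚ.* inv! n ≡ (minusOne (E j) ^ₛ k) n /! k
  S⁽⁾-egf zero    n k = begin
    ι (#partitions n (whole n) k) ℚ.* inv! n
      ≡⟨ cong (ℚ._* inv! n) (#partitions≡ k n (whole n)) ⟩
    ι (size n (whole n) !) ℚ.* stirlingCoeff k (size n (whole n)) ℚ.* inv! n
      ≡⟨ cong (λ z → ι (z !) ℚ.* stirlingCoeff k z ℚ.* inv! n) (countBelow-all n _ (bit-whole n)) ⟩
    ι (n !) ℚ.* stirlingCoeff k n ℚ.* inv! n
      ≡⟨ solve 3 (λ a c u → a :* c :* u := (u :* a) :* c) refl (ι (n !)) (stirlingCoeff k n) (inv! n) ⟩
    inv! n ℚ.* ι (n !) ℚ.* stirlingCoeff k n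
      ≡⟨ cong (ℚ._* stirlingCoeff k n) (inv!*n!≡1 n) ⟩
    1ℚ ℚ.* stirlingCoeff k n
      ≡⟨ ℚP.*-identityˡ (stirlingCoeff k n) ⟩
    stirlingCoeff k n ∎
  S⁽⁾-egf (suc j) n k = begin
    ι (S⁽ suc (suc j) ⁾ n k) ℚ.* inv! n
      ≡⟨ cong (ℚ._* inv! n) (S⁽⁾-by-parent j n k) ⟩
    Σ (suc s) (λ r → ι (S⁽ suc j ⁾ n r) ℚ.* (ι (r !) ℚ.* stirlingCoeff k r)) ℚ.* inv! n
      ≡⟨ Σ-*ʳ (suc s) (inv! n) _ ⟩
    Σ (suc s) (λ r → ι (S⁽ suc j ⁾ n r) ℚ.* (ι (r !) ℚ.* stirlingCoeff k r) ℚ.* inv! n)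
      ≡⟨ Σ-cong (suc s) (λ r _ → term r) ⟩
    Σ (suc s) (λ r → (g ^ₛ r) n ℚ.* stirlingCoeff k r)
      ≡⟨ ∘ₛ-expm1^ g (minusOne-E-0 j) k n s (n≤card n (suc j)) ⟩
    (minusOne (E (suc j)) ^ₛ k) n /! k ∎
    where
    s = card n (suc j)
    g = minusOne (E j)
    term : ∀ r → ι (S⁽ suc j ⁾ n r) ℚ.* (ι (r !) ℚ.* stirlingCoeff k r) ℚ.* inv! n ≡ (g ^ₛ r) n ℚ.* stirlingCoeff k r
    term r = begin
      ι (S⁽ suc j ⁾ n r) ℚ.* (ι (r !) ℚ.* c) ℚ.* inv! n
        ≡⟨ solve 4 (λ a f c u → a :* (f :* c) :* u := (a :* u) :* (f :* c)) refl (ι (S⁽ suc j ⁾ n r)) (ι (r !)) c (inv! n) ⟩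
      ι (S⁽ suc j ⁾ n r) ℚ.* inv! n ℚ.* (ι (r !) ℚ.* c)
        ≡⟨ cong (ℚ._* (ι (r !) ℚ.* c)) (S⁽⁾-egf j n r) ⟩
      (g ^ₛ r) n ℚ.* inv! r ℚ.* (ι (r !) ℚ.* c)
        ≡⟨ solve 4 (λ a u f c → a :* u :* (f :* c) := a :* (u :* f) :* c) refl ((g ^ₛ r) n) (inv! r) (ι (r !)) c ⟩
      (g ^ₛ r) n ℚ.* (inv! r ℚ.* ι (r !)) ℚ.* c
        ≡⟨ cong (λ z → (g ^ₛ r) n ℚ.* z ℚ.* c) (inv!*n!≡1 r) ⟩
      (g ^ₛ r) n ℚ.* 1ℚ ℚ.* c
        ≡⟨ cong (ℚ._* c) (ℚP.*-identityʳ ((g ^ₛ r) n)) ⟩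
      (g ^ₛ r) n ℚ.* c ∎
      where c = stirlingCoeff k r

open PowerSeries using (^ₛ-vanishes-below)
open HigherOrderStirling using (minusOne-E-0; S⁽⁾-egf)
import Data.Rational.Properties as ℚP
open import Relation.Binary.PropositionalEquality using (sym; trans; cong)

theorem2 : (m k : ℕ) → 1 ≤ m → 1 ≤ k →
    (n : ℕ) → stirlingEGF m k n ≡ ((minusOne (E (m ∸ 1)) ^ₛ k) n /! k)
theorem2 (suc j) k _ 1≤k zero    = sym (trans (cong (_/! k) (^ₛ-vanishes-below (minusOne (E j)) (minusOne-E-0 j) k 0 1≤k))
                                              (ℚP.*-zeroˡ (inv! k)))
theorem2 (suc j) k _ _   (suc n) = S⁽⁾-egf j (suc n) k
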